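{- Let $\vec{u},\vec{v}\in\mathbb{Z}^2$ be linearly independent and let $P=\{t_1\vec{u}+t_2\vec{v} : 0\le t_1,t_2\le 1\}$. Assume $P$ is clean, i.e. the only lattice points on the boundary of $P$ are its four vertices $0,\vec{u},\vec{v},\vec{u}+\vec{v}$, and let $n=\mathrm{area}(P)$, where $n\ge 2$. Then there exist a unimodular linear transformation $T:\mathbb{R}^2\to\mathbb{R}^2$ and an integer $a$ with $1\le a<n$ and $\gcd(a,n)=1$ such that $T(P)=P_{a,n}$. Furthermore, for any such $T$ and $a$: $$V(P)=1 \iff a=n-1, \qquad V(P)=n-1 \iff a=1.$$ Geometrically: (i) all but one of the lattice points in the interior of $P$ are not visible if and only if all of the $n-1$ interior lattice points of $P$ lie on the diagonal $\{t(\vec{u}+\vec{v}) : 0\le t\le 1\}$; (ii) all the lattice points in the interior of $P$ are visible if and only if all of these lattice points lie on the diagonal $\{t\vec{u}+(1-t)\vec{v} : 0\le t\le 1\}$.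
   Context: A lattice point $(u_1,u_2)\in\mathbb{Z}^2$ is visible (from the origin) if $\gcd(u_1,u_2)=1$. A linear map $T:\mathbb{R}^2\to\mathbb{R}^2$ is unimodular if it is represented by a $2\times 2$ integer matrix of determinant $\pm1$. For a lattice parallelogram $P$ with a vertex at the origin, $V(P)$ denotes the number of visible lattice points in the interior of $P$. For integers $1\le a<n$ with $\gcd(a,n)=1$, $P_{a,n}=\{t_1(1,0)+t_2(a,n) : 0\le t_1,t_2\le 1\}$ is the parallelogram with vertices $(0,0),(1,0),(a,n),(a+1,n)$.
   Formalization: Points of the plane, including those acted on by T and compared in $T(P)=P_{a,n}$, have rational coordinates instead of real ones, and the coefficients $t_1,t_2$ and $t$ are rational. -}

module Defs where

open import Data.Nat using (ℕ)
open import Data.Integer as ℤ using (ℤ; +_; ∣_∣)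
open import Data.Rational as ℚ using (ℚ; _/_; 0ℚ; 1ℚ; _≤_; _<_; _+_; _*_; _-_)
open import Data.Product using (_×_; _,_; ∃; ∃-syntax; proj₁; proj₂)
open import Data.Sum using (_⊎_)
open import Data.List using (List; length)
open import Data.List.Membership.Propositional using (_∈_)
open import Data.List.Relation.Unary.Unique.Propositional using (Unique)
open import Relation.Binary.PropositionalEquality using (_≡_)
open import Relation.Nullary using (¬_)
open import Function.Bundles using (_⇔_)
import Data.Nat.GCD as ℕG

ℤ² : Set
ℤ² = ℤ × ℤ

ℚ² : Set
ℚ² = ℚ × ℚ

ι : ℤ → ℚ
ι i = i / 1

ι² : ℤ² → ℚ²
ι² (x , y) = (ι x , ι y)

_+²_ : ℤ² → ℤ² → ℤ²
(a , b) +² (c , d) = (a ℤ.+ c , b ℤ.+ d)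

0² : ℤ²
0² = (+ 0 , + 0)

lin : ℚ → ℚ² → ℚ → ℚ² → ℚ²
lin t₁ (p₁ , p₂) t₂ (q₁ , q₂) = (t₁ * p₁ + t₂ * q₁ , t₁ * p₂ + t₂ * q₂)

det : ℤ² → ℤ² → ℤ
det (u₁ , u₂) (v₁ , v₂) = u₁ ℤ.* v₂ ℤ.- u₂ ℤ.* v₁

area : ℤ² → ℤ² → ℕ
area u v = ∣ det u v ∣

InPar : ℤ² → ℤ² → ℚ² → Set
InPar u v x = ∃[ t₁ ] ∃[ t₂ ]
  ((0ℚ ≤ t₁ × t₁ ≤ 1ℚ) × (0ℚ ≤ t₂ × t₂ ≤ 1ℚ) × x ≡ lin t₁ (ι² u) t₂ (ι² v))

-- x in the interior of P(u,v): 0 < t₁, t₂ < 1  (u, v linearly independent)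
InInterior : ℤ² → ℤ² → ℚ² → Set
InInterior u v x = ∃[ t₁ ] ∃[ t₂ ]
  ((0ℚ < t₁ × t₁ < 1ℚ) × (0ℚ < t₂ × t₂ < 1ℚ) × x ≡ lin t₁ (ι² u) t₂ (ι² v))

OnBoundary : ℤ² → ℤ² → ℤ² → Set
OnBoundary u v w = InPar u v (ι² w) × ¬ InInterior u v (ι² w)

Clean : ℤ² → ℤ² → Set
Clean u v = ∀ w → OnBoundary u v w →
  w ≡ 0² ⊎ w ≡ u ⊎ w ≡ v ⊎ w ≡ u +² v

Visible : ℤ² → Set
Visible (w₁ , w₂) = ℕG.gcd ∣ w₁ ∣ ∣ w₂ ∣ ≡ 1

VisInt : ℤ² → ℤ² → ℤ² → Set
VisInt u v w = InInterior u v (ι² w) × Visible w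

HasCard : (ℤ² → Set) → ℕ → Set
HasCard S k = ∃[ xs ] (Unique xs × (∀ w → (w ∈ xs ⇔ S w)) × length xs ≡ k)

V≡ : ℤ² → ℤ² → ℕ → Set
V≡ u v k = HasCard (VisInt u v) k

record Mat2 : Set where
  constructor mat
  field
    m₁₁ m₁₂ m₂₁ m₂₂ : ℤ

Unimodular : Mat2 → Set
Unimodular (mat a b c d) = a ℤ.* d ℤ.- b ℤ.* c ≡ + 1 ⊎ a ℤ.* d ℤ.- b ℤ.* c ≡ ℤ.- + 1

apply : Mat2 → ℚ² → ℚ²
apply (mat a b c d) (x , y) = (ι a * x + ι b * y , ι c * x + ι d * y)

MapsOnto : Mat2 → ℤ² → ℤ² → ℤ² → ℤ² → Set
MapsOnto T u v p q = ∀ (x : ℚ²) →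
  ((∃[ y ] (InPar u v y × apply T y ≡ x)) ⇔ InPar p q x)

-- P_{a,n} spanned by (1,0) and (a,n)
e₁ : ℤ²
e₁ = (+ 1 , + 0)

OnMainDiag : ℤ² → ℤ² → ℤ² → Set
OnMainDiag u v w = ∃[ t ] ((0ℚ ≤ t × t ≤ 1ℚ) × ι² w ≡ lin t (ι² (u +² v)) 0ℚ (ι² 0²))

OnAntiDiag : ℤ² → ℤ² → ℤ² → Set
OnAntiDiag u v w = ∃[ t ] ((0ℚ ≤ t × t ≤ 1ℚ) × ι² w ≡ lin t (ι² u) (1ℚ - t) (ι² v))

-- By Cramer's rule the lattice points of P(u,v) are the w with 0 ≤ det(w,v), det(u,w) ≤ n, the
-- interior ones those with strict inequalities.  Cleanness forces u and v to be primitive, so a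
-- Bézout row for u completes to a unimodular T with T u = e₁ and T v = (a , n), 0 < a < n.
-- Conversely any unimodular T mapping P onto P_{a,n} sends the edges to the edges, because a
-- basis of determinant ±n inside P_{a,n} consists of its edge vectors.  Unimodular maps
-- preserve visibility, so everything reduces to P_{a,n}, whose interior lattice points are the
-- (x , y) with 0 < y < n and ya < xn < ya + n, one for each y.  For a = n - 1 these are the
-- (y , y), of which only (1 , 1) is visible; for a = 1 they are the (1 , y), all visible.
-- Otherwise (1 , 1) and (Q , Q + 1) are two visible ones, and if a ≥ 2 then (2 , 2Q + 2) is an
-- invisible one, for suitable Q.  The diagonal statements follow by locating (1 , 1).
{-# OPTIONS --safe #-}
module Submission where

open import Defs
open import Data.Nat using (ℕ; _≤_; _<_; _∸_; zero; suc; z≤n; s≤s)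
open import Data.Product using (_×_; _,_; ∃-syntax; proj₁; proj₂; swap)
open import Relation.Binary.PropositionalEquality
  using (_≡_; _≢_; refl; sym; trans; cong; cong₂; subst; subst₂; module ≡-Reasoning)
open import Function.Bundles using (_⇔_; mk⇔; Equivalence)
import Function.Properties.Equivalence as ⇔
import Data.Nat as ℕ
import Data.Nat.Properties as ℕP
open import Data.Nat.GCD as ℕG using (gcd)
import Data.Nat.Divisibility as ℕD
import Data.Nat.DivMod as ℕDM
import Data.Nat.Coprimality as Cop
import Data.Integer as ℤ
open ℤ using (ℤ; +_; -[1+_]; ∣_∣)
import Data.Integer.Properties as ℤP
import Data.Integer.Divisibility.Signed as ℤD
import Data.Integer.DivMod as ℤDM
import Data.Rational as ℚ
open ℚ using (ℚ; mkℚ; 0ℚ; 1ℚ)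
import Data.Rational.Properties as ℚP
open import Data.Sum using (_⊎_; inj₁; inj₂)
open import Data.Empty using (⊥-elim)
open import Relation.Nullary using (¬_; yes; no)
open import Relation.Nullary.Decidable using (decidable-stable)
open import Data.Maybe using (Maybe; just; nothing)
open import Data.List using (List; []; _∷_; length; map; filter; upTo)
open import Data.List.Membership.Propositional using (_∈_)
open import Data.List.Relation.Unary.Unique.Propositional using (Unique)
open import Data.List.Relation.Unary.Any using (here; there)
open import Data.List.Relation.Unary.All using (All; []; _∷_; lookup)
import Data.List.Relation.Unary.All.Properties as AllP
open import Data.List.Relation.Unary.AllPairs using ([]; _∷_)
import Data.List.Relation.Unary.Unique.Propositional.Properties as UniqueP
import Data.List.Properties as ListP
import Data.List.Membership.Propositional.Properties as ∈P
open import Level using (0ℓ)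
open import Tactic.RingSolver using (solve-∀)
import Tactic.RingSolver.Core.AlmostCommutativeRing as ACR
open import Data.Nat.Tactic.RingSolver using () renaming (solve-∀ to solveℕ)
open import Data.Integer.Tactic.RingSolver using () renaming (solve-∀ to solveℤ)

ℚ-ring : ACR.AlmostCommutativeRing 0ℓ 0ℓ
ℚ-ring = ACR.fromCommutativeRing ℚP.+-*-commutativeRing isZero
  where
  isZero : ∀ x → Maybe (0ℚ ≡ x)
  isZero x with 0ℚ ℚP.≟ x
  ... | yes p = just p
  ... | no _  = nothing

ι≡mkℚ : ∀ i → ι i ≡ mkℚ i 0 (Cop.sym (Cop.1-coprimeTo ∣ i ∣))
ι≡mkℚ i = ℚP.↥p/↧p≡p _

ι-+ : ∀ i j → ι (i ℤ.+ j) ≡ ι i ℚ.+ ι j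
ι-+ i j rewrite ι≡mkℚ i | ι≡mkℚ j | ℤP.*-identityʳ i | ℤP.*-identityʳ j = refl

ι-* : ∀ i j → ι (i ℤ.* j) ≡ ι i ℚ.* ι j
ι-* i j rewrite ι≡mkℚ i | ι≡mkℚ j = refl

ι-neg : ∀ i → ι (ℤ.- i) ≡ ℚ.- ι i
ι-neg i rewrite ι≡mkℚ i | ι≡mkℚ (ℤ.- i) with i
... | + zero   = refl
... | + suc n  = refl
... | -[1+ n ] = refl

ι-sub : ∀ i j → ι (i ℤ.- j) ≡ ι i ℚ.- ι j
ι-sub i j = trans (ι-+ i (ℤ.- j)) (cong (ι i ℚ.+_) (ι-neg j))

ι-linear : ∀ a x b y → ι (a ℤ.* x ℤ.+ b ℤ.* y) ≡ ι a ℚ.* ι x ℚ.+ ι b ℚ.* ι y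
ι-linear a x b y rewrite ι-+ (a ℤ.* x) (b ℤ.* y) | ι-* a x | ι-* b y = refl

ι-det : ∀ p₁ p₂ q₁ q₂ → ι (det (p₁ , p₂) (q₁ , q₂)) ≡ ι p₁ ℚ.* ι q₂ ℚ.- ι p₂ ℚ.* ι q₁
ι-det p₁ p₂ q₁ q₂ rewrite ι-sub (p₁ ℤ.* q₂) (p₂ ℤ.* q₁) | ι-* p₁ q₂ | ι-* p₂ q₁ = refl

ι-mono-≤ : ∀ {i j} → i ℤ.≤ j → ι i ℚ.≤ ι j
ι-mono-≤ {i} {j} i≤j rewrite ι≡mkℚ i | ι≡mkℚ j =
  ℚ.*≤* (subst₂ ℤ._≤_ (sym (ℤP.*-identityʳ i)) (sym (ℤP.*-identityʳ j)) i≤j)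

ι-cancel-≤ : ∀ {i j} → ι i ℚ.≤ ι j → i ℤ.≤ j
ι-cancel-≤ {i} {j} ιi≤ιj rewrite ι≡mkℚ i | ι≡mkℚ j with ιi≤ιj
... | ℚ.*≤* i≤j rewrite ℤP.*-identityʳ i | ℤP.*-identityʳ j = i≤j

ι-mono-< : ∀ {i j} → i ℤ.< j → ι i ℚ.< ι j
ι-mono-< {i} {j} i<j rewrite ι≡mkℚ i | ι≡mkℚ j =
  ℚ.*<* (subst₂ ℤ._<_ (sym (ℤP.*-identityʳ i)) (sym (ℤP.*-identityʳ j)) i<j)

ι-cancel-< : ∀ {i j} → ι i ℚ.< ι j → i ℤ.< j
ι-cancel-< {i} {j} ιi<ιj rewrite ι≡mkℚ i | ι≡mkℚ j with ιi<ιj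
... | ℚ.*<* i<j rewrite ℤP.*-identityʳ i | ℤP.*-identityʳ j = i<j

ι-injective : ∀ {i j} → ι i ≡ ι j → i ≡ j
ι-injective e = ℤP.≤-antisym (ι-cancel-≤ (ℚP.≤-reflexive e)) (ι-cancel-≤ (ℚP.≤-reflexive (sym e)))

ι-positive : ∀ m → ℚ.Positive (ι (+ suc m))
ι-positive m rewrite ι≡mkℚ (+ suc m) = _

module Fraction (m : ℕ) where
  private
    r : ℚ
    r = ι (+ suc m)
    instance
      r-positive : ℚ.Positive r
      r-positive = ι-positive m
      r-nonZero : ℚ.NonZero r
      r-nonZero = ℚP.pos⇒nonZero r
      r-nonNeg : ℚ.NonNegative r
      r-nonNeg = ℚP.pos⇒nonNeg r

  frac : ℤ → ℚ
  frac i = ι i ℚ.* ℚ.1/ r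

  frac-*-denominator : ∀ i → frac i ℚ.* r ≡ ι i
  frac-*-denominator i = begin
    ι i ℚ.* ℚ.1/ r ℚ.* r   ≡⟨ ℚP.*-assoc (ι i) (ℚ.1/ r) r ⟩
    ι i ℚ.* (ℚ.1/ r ℚ.* r) ≡⟨ cong (ι i ℚ.*_) (ℚP.*-inverseˡ r) ⟩
    ι i ℚ.* 1ℚ             ≡⟨ ℚP.*-identityʳ (ι i) ⟩
    ι i                    ∎
    where open ≡-Reasoning

  frac-nonNeg : ∀ {i} → + 0 ℤ.≤ i → 0ℚ ℚ.≤ frac i
  frac-nonNeg {i} 0≤i = ℚP.*-cancelʳ-≤-pos r
    (subst₂ ℚ._≤_ (sym (ℚP.*-zeroˡ r)) (sym (frac-*-denominator i)) (ι-mono-≤ 0≤i))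

  frac≤1 : ∀ {i} → i ℤ.≤ + suc m → frac i ℚ.≤ 1ℚ
  frac≤1 {i} i≤N = ℚP.*-cancelʳ-≤-pos r
    (subst₂ ℚ._≤_ (sym (frac-*-denominator i)) (sym (ℚP.*-identityˡ r)) (ι-mono-≤ i≤N))

  frac-pos : ∀ {i} → + 0 ℤ.< i → 0ℚ ℚ.< frac i
  frac-pos {i} 0<i = ℚP.*-cancelʳ-<-nonNeg r
    (subst₂ ℚ._<_ (sym (ℚP.*-zeroˡ r)) (sym (frac-*-denominator i)) (ι-mono-< 0<i))

  frac<1 : ∀ {i} → i ℤ.< + suc m → frac i ℚ.< 1ℚ
  frac<1 {i} i<N = ℚP.*-cancelʳ-<-nonNeg r
    (subst₂ ℚ._<_ (sym (frac-*-denominator i)) (sym (ℚP.*-identityˡ r)) (ι-mono-< i<N))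

  ≡frac : ∀ x i → x ℚ.* r ≡ ι i → x ≡ frac i
  ≡frac x i e = begin
    x                    ≡⟨ sym (ℚP.*-identityʳ x) ⟩
    x ℚ.* 1ℚ             ≡⟨ cong (x ℚ.*_) (sym (ℚP.*-inverseʳ r)) ⟩
    x ℚ.* (r ℚ.* ℚ.1/ r) ≡⟨ sym (ℚP.*-assoc x r (ℚ.1/ r)) ⟩
    x ℚ.* r ℚ.* ℚ.1/ r   ≡⟨ cong (ℚ._* ℚ.1/ r) e ⟩
    frac i               ∎
    where open ≡-Reasoning

  frac-linear : ∀ a x b y → frac (a ℤ.* x ℤ.+ b ℤ.* y) ≡ frac a ℚ.* ι x ℚ.+ frac b ℚ.* ι y
  frac-linear a x b y = trans (cong (ℚ._* ℚ.1/ r) (ι-linear a x b y)) (distrib (ι a) (ι x) (ι b) (ι y) (ℚ.1/ r))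
    where
    distrib : ∀ A X B Y i → (A ℚ.* X ℚ.+ B ℚ.* Y) ℚ.* i ≡ (A ℚ.* i) ℚ.* X ℚ.+ (B ℚ.* i) ℚ.* Y
    distrib = solve-∀ ℚ-ring

  unit-multiple-bounds : ∀ i t → ι i ≡ t ℚ.* r → 0ℚ ℚ.≤ t → t ℚ.≤ 1ℚ →
    (+ 0 ℤ.≤ i) × (i ℤ.≤ + suc m)
  unit-multiple-bounds i t e 0≤t t≤1 =
    ι-cancel-≤ (subst₂ ℚ._≤_ (ℚP.*-zeroˡ r) (sym e) (ℚP.*-monoʳ-≤-nonNeg r 0≤t)) ,
    ι-cancel-≤ (subst₂ ℚ._≤_ (sym e) (ℚP.*-identityˡ r) (ℚP.*-monoʳ-≤-nonNeg r t≤1))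

  unit-multiple-bounds< : ∀ i t → ι i ≡ t ℚ.* r → 0ℚ ℚ.< t → t ℚ.< 1ℚ →
    (+ 0 ℤ.< i) × (i ℤ.< + suc m)
  unit-multiple-bounds< i t e 0<t t<1 =
    ι-cancel-< (subst₂ ℚ._<_ (ℚP.*-zeroˡ r) (sym e) (ℚP.*-monoˡ-<-pos r 0<t)) ,
    ι-cancel-< (subst₂ ℚ._<_ (sym e) (ℚP.*-identityˡ r) (ℚP.*-monoˡ-<-pos r t<1))

-- Coordinates with respect to a lattice basis

cramer : ∀ p q w t₁ t₂ → ι² w ≡ lin t₁ (ι² p) t₂ (ι² q) →
  (ι (det w q) ≡ t₁ ℚ.* ι (det p q)) × (ι (det p w) ≡ t₂ ℚ.* ι (det p q))
cramer (p₁ , p₂) (q₁ , q₂) (w₁ , w₂) t₁ t₂ e =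
  (begin
    ι (det (w₁ , w₂) (q₁ , q₂))     ≡⟨ ι-det w₁ w₂ q₁ q₂ ⟩
    ι w₁ ℚ.* ι q₂ ℚ.- ι w₂ ℚ.* ι q₁ ≡⟨ cong₂ (λ x y → x ℚ.* ι q₂ ℚ.- y ℚ.* ι q₁) x≡ y≡ ⟩
    _                               ≡⟨ first t₁ t₂ (ι p₁) (ι p₂) (ι q₁) (ι q₂) ⟩
    _                               ≡⟨ cong (t₁ ℚ.*_) (sym (ι-det p₁ p₂ q₁ q₂)) ⟩
    t₁ ℚ.* ι (det (p₁ , p₂) (q₁ , q₂)) ∎) ,
  (begin
    ι (det (p₁ , p₂) (w₁ , w₂))     ≡⟨ ι-det p₁ p₂ w₁ w₂ ⟩
    ι p₁ ℚ.* ι w₂ ℚ.- ι p₂ ℚ.* ι w₁ ≡⟨ cong₂ (λ y x → ι p₁ ℚ.* y ℚ.- ι p₂ ℚ.* x) y≡ x≡ ⟩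
    _                               ≡⟨ second t₁ t₂ (ι p₁) (ι p₂) (ι q₁) (ι q₂) ⟩
    _                               ≡⟨ cong (t₂ ℚ.*_) (sym (ι-det p₁ p₂ q₁ q₂)) ⟩
    t₂ ℚ.* ι (det (p₁ , p₂) (q₁ , q₂)) ∎)
  where
  open ≡-Reasoning
  x≡ : ι w₁ ≡ t₁ ℚ.* ι p₁ ℚ.+ t₂ ℚ.* ι q₁
  x≡ = cong proj₁ e
  y≡ : ι w₂ ≡ t₁ ℚ.* ι p₂ ℚ.+ t₂ ℚ.* ι q₂
  y≡ = cong proj₂ e
  first : ∀ t₁ t₂ P₁ P₂ Q₁ Q₂ →
    (t₁ ℚ.* P₁ ℚ.+ t₂ ℚ.* Q₁) ℚ.* Q₂ ℚ.- (t₁ ℚ.* P₂ ℚ.+ t₂ ℚ.* Q₂) ℚ.* Q₁ ≡ t₁ ℚ.* (P₁ ℚ.* Q₂ ℚ.- P₂ ℚ.* Q₁)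
  first = solve-∀ ℚ-ring
  second : ∀ t₁ t₂ P₁ P₂ Q₁ Q₂ →
    P₁ ℚ.* (t₁ ℚ.* P₂ ℚ.+ t₂ ℚ.* Q₂) ℚ.- P₂ ℚ.* (t₁ ℚ.* P₁ ℚ.+ t₂ ℚ.* Q₁) ≡ t₂ ℚ.* (P₁ ℚ.* Q₂ ℚ.- P₂ ℚ.* Q₁)
  second = solve-∀ ℚ-ring

det-expansion : ∀ p q w →
  (proj₁ w ℤ.* det p q ≡ det w q ℤ.* proj₁ p ℤ.+ det p w ℤ.* proj₁ q) ×
  (proj₂ w ℤ.* det p q ≡ det w q ℤ.* proj₂ p ℤ.+ det p w ℤ.* proj₂ q)
det-expansion (p₁ , p₂) (q₁ , q₂) (w₁ , w₂) = first w₁ w₂ p₁ p₂ q₁ q₂ , second w₁ w₂ p₁ p₂ q₁ q₂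
  where
  first : ∀ w₁ w₂ p₁ p₂ q₁ q₂ → w₁ ℤ.* (p₁ ℤ.* q₂ ℤ.- p₂ ℤ.* q₁)
    ≡ (w₁ ℤ.* q₂ ℤ.- w₂ ℤ.* q₁) ℤ.* p₁ ℤ.+ (p₁ ℤ.* w₂ ℤ.- p₂ ℤ.* w₁) ℤ.* q₁
  first = solveℤ
  second : ∀ w₁ w₂ p₁ p₂ q₁ q₂ → w₂ ℤ.* (p₁ ℤ.* q₂ ℤ.- p₂ ℤ.* q₁)
    ≡ (w₁ ℤ.* q₂ ℤ.- w₂ ℤ.* q₁) ℤ.* p₂ ℤ.+ (p₁ ℤ.* w₂ ℤ.- p₂ ℤ.* w₁) ℤ.* q₂
  second = solveℤ

module Parallelogram (p q : ℤ²) (m : ℕ) (det≡ : det p q ≡ + suc m) where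
  open Fraction m

  private
    in-units : ∀ i t → ι i ≡ t ℚ.* ι (det p q) → ι i ≡ t ℚ.* ι (+ suc m)
    in-units i t e = trans e (cong (λ d → t ℚ.* ι d) det≡)

  DetBounds : ℤ² → Set
  DetBounds w = ((+ 0 ℤ.≤ det w q) × (det w q ℤ.≤ + suc m)) × ((+ 0 ℤ.≤ det p w) × (det p w ℤ.≤ + suc m))

  InPar⇒det-bounds : ∀ w → InPar p q (ι² w) → DetBounds w
  InPar⇒det-bounds w (t₁ , t₂ , (0≤t₁ , t₁≤1) , (0≤t₂ , t₂≤1) , e) =
    unit-multiple-bounds (det w q) t₁ (in-units (det w q) t₁ (proj₁ (cramer p q w t₁ t₂ e))) 0≤t₁ t₁≤1 ,
    unit-multiple-bounds (det p w) t₂ (in-units (det p w) t₂ (proj₂ (cramer p q w t₁ t₂ e))) 0≤t₂ t₂≤1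

  InInterior⇒det-bounds : ∀ w → InInterior p q (ι² w) →
    ((+ 0 ℤ.< det w q) × (det w q ℤ.< + suc m)) × ((+ 0 ℤ.< det p w) × (det p w ℤ.< + suc m))
  InInterior⇒det-bounds w (t₁ , t₂ , (0<t₁ , t₁<1) , (0<t₂ , t₂<1) , e) =
    unit-multiple-bounds< (det w q) t₁ (in-units (det w q) t₁ (proj₁ (cramer p q w t₁ t₂ e))) 0<t₁ t₁<1 ,
    unit-multiple-bounds< (det p w) t₂ (in-units (det p w) t₂ (proj₂ (cramer p q w t₁ t₂ e))) 0<t₂ t₂<1

  coordinates : ∀ w → ι² w ≡ lin (frac (det w q)) (ι² p) (frac (det p w)) (ι² q)
  coordinates w@(w₁ , w₂) = cong₂ _,_
    (coordinate w₁ (proj₁ p) (proj₁ q) (proj₁ (det-expansion p q w)))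
    (coordinate w₂ (proj₂ p) (proj₂ q) (proj₂ (det-expansion p q w)))
    where
    coordinate : ∀ z a b → z ℤ.* det p q ≡ det w q ℤ.* a ℤ.+ det p w ℤ.* b →
      ι z ≡ frac (det w q) ℚ.* ι a ℚ.+ frac (det p w) ℚ.* ι b
    coordinate z a b e = begin
      ι z                                       ≡⟨ ≡frac (ι z) (z ℤ.* + suc m) (sym (ι-* z (+ suc m))) ⟩
      frac (z ℤ.* + suc m)                      ≡⟨ cong (λ d → frac (z ℤ.* d)) (sym det≡) ⟩
      frac (z ℤ.* det p q)                      ≡⟨ cong frac e ⟩
      frac (det w q ℤ.* a ℤ.+ det p w ℤ.* b)    ≡⟨ frac-linear (det w q) a (det p w) b ⟩
      frac (det w q) ℚ.* ι a ℚ.+ frac (det p w) ℚ.* ι b ∎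
      where open ≡-Reasoning

  det-bounds⇒InInterior : ∀ w →
    + 0 ℤ.< det w q → det w q ℤ.< + suc m → + 0 ℤ.< det p w → det p w ℤ.< + suc m →
    InInterior p q (ι² w)
  det-bounds⇒InInterior w b₁ b₂ b₃ b₄ =
    frac (det w q) , frac (det p w) , (frac-pos b₁ , frac<1 b₂) , (frac-pos b₃ , frac<1 b₄) , coordinates w

act : Mat2 → ℤ² → ℤ²
act (mat a b c d) (x , y) = (a ℤ.* x ℤ.+ b ℤ.* y , c ℤ.* x ℤ.+ d ℤ.* y)

detM : Mat2 → ℤ
detM (mat a b c d) = a ℤ.* d ℤ.- b ℤ.* c

infix 4 _≡±_
_≡±_ : ℤ → ℤ → Set
i ≡± j = i ≡ j ⊎ i ≡ ℤ.- j

apply-ι² : ∀ T w → apply T (ι² w) ≡ ι² (act T w)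
apply-ι² (mat a b c d) (x , y) = cong₂ _,_ (sym (ι-linear a x b y)) (sym (ι-linear c x d y))

apply-lin : ∀ T t₁ x t₂ y → apply T (lin t₁ x t₂ y) ≡ lin t₁ (apply T x) t₂ (apply T y)
apply-lin (mat a b c d) t₁ (x₁ , x₂) t₂ (y₁ , y₂) =
  cong₂ _,_ (regroup (ι a) (ι b) t₁ x₁ t₂ y₁ x₂ y₂) (regroup (ι c) (ι d) t₁ x₁ t₂ y₁ x₂ y₂)
  where
  regroup : ∀ a b t₁ x₁ t₂ y₁ x₂ y₂ →
    a ℚ.* (t₁ ℚ.* x₁ ℚ.+ t₂ ℚ.* y₁) ℚ.+ b ℚ.* (t₁ ℚ.* x₂ ℚ.+ t₂ ℚ.* y₂)
    ≡ t₁ ℚ.* (a ℚ.* x₁ ℚ.+ b ℚ.* x₂) ℚ.+ t₂ ℚ.* (a ℚ.* y₁ ℚ.+ b ℚ.* y₂)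
  regroup = solve-∀ ℚ-ring

act-lin : ∀ T x y w t₁ t₂ → ι² w ≡ lin t₁ (ι² x) t₂ (ι² y) →
  ι² (act T w) ≡ lin t₁ (ι² (act T x)) t₂ (ι² (act T y))
act-lin T x y w t₁ t₂ e = begin
  ι² (act T w)                                ≡⟨ sym (apply-ι² T w) ⟩
  apply T (ι² w)                              ≡⟨ cong (apply T) e ⟩
  apply T (lin t₁ (ι² x) t₂ (ι² y))           ≡⟨ apply-lin T t₁ (ι² x) t₂ (ι² y) ⟩
  lin t₁ (apply T (ι² x)) t₂ (apply T (ι² y)) ≡⟨ cong₂ (λ x′ y′ → lin t₁ x′ t₂ y′) (apply-ι² T x) (apply-ι² T y) ⟩
  lin t₁ (ι² (act T x)) t₂ (ι² (act T y))     ∎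
  where open ≡-Reasoning

act-+² : ∀ T u v → act T (u +² v) ≡ act T u +² act T v
act-+² (mat a b c d) (x , y) (x′ , y′) = cong₂ _,_ (distrib a b x y x′ y′) (distrib c d x y x′ y′)
  where
  distrib : ∀ a b x y x′ y′ →
    a ℤ.* (x ℤ.+ x′) ℤ.+ b ℤ.* (y ℤ.+ y′) ≡ (a ℤ.* x ℤ.+ b ℤ.* y) ℤ.+ (a ℤ.* x′ ℤ.+ b ℤ.* y′)
  distrib = solveℤ

act-0² : ∀ T → act T 0² ≡ 0²
act-0² (mat a b c d) rewrite ℤP.*-zeroʳ a | ℤP.*-zeroʳ b | ℤP.*-zeroʳ c | ℤP.*-zeroʳ d = refl

det-act : ∀ T u v → det (act T u) (act T v) ≡ detM T ℤ.* det u v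
det-act (mat a b c d) (x , y) (x′ , y′) = multiplicative a b c d x y x′ y′
  where
  multiplicative : ∀ a b c d x y x′ y′ →
    (a ℤ.* x ℤ.+ b ℤ.* y) ℤ.* (c ℤ.* x′ ℤ.+ d ℤ.* y′) ℤ.- (c ℤ.* x ℤ.+ d ℤ.* y) ℤ.* (a ℤ.* x′ ℤ.+ b ℤ.* y′)
    ≡ (a ℤ.* d ℤ.- b ℤ.* c) ℤ.* (x ℤ.* y′ ℤ.- y ℤ.* x′)
  multiplicative = solveℤ

-- For unimodular T this is T⁻¹, since then (det T)² = 1.
inverse : Mat2 → Mat2
inverse T@(mat a b c d) = mat (detM T ℤ.* d) (ℤ.- (detM T ℤ.* b)) (ℤ.- (detM T ℤ.* c)) (detM T ℤ.* a)

Unimodular-det² : ∀ T → Unimodular T → detM T ℤ.* detM T ≡ + 1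
Unimodular-det² (mat a b c d) (inj₁ e) rewrite e = refl
Unimodular-det² (mat a b c d) (inj₂ e) rewrite e = refl

Unimodular-inverse : ∀ T → Unimodular T → Unimodular (inverse T)
Unimodular-inverse T@(mat a b c d) U =
  subst (_≡± + 1) (sym (det-inverse a b c d)) (cube U)
  where
  det-inverse : ∀ a b c d → let e = a ℤ.* d ℤ.- b ℤ.* c in
    (e ℤ.* d) ℤ.* (e ℤ.* a) ℤ.- (ℤ.- (e ℤ.* b)) ℤ.* (ℤ.- (e ℤ.* c)) ≡ e ℤ.* e ℤ.* e
  det-inverse = solveℤ
  cube : Unimodular T → detM T ℤ.* detM T ℤ.* detM T ≡± + 1
  cube (inj₁ e) rewrite e = inj₁ refl
  cube (inj₂ e) rewrite e = inj₂ refl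

private
  det²-* : ∀ T → Unimodular T → ∀ z → detM T ℤ.* detM T ℤ.* z ≡ z
  det²-* T U z = trans (cong (ℤ._* z) (Unimodular-det² T U)) (ℤP.*-identityˡ z)

inverse-actˡ : ∀ T → Unimodular T → ∀ w → act (inverse T) (act T w) ≡ w
inverse-actˡ T@(mat a b c d) U (x , y) =
  cong₂ _,_ (trans (first a b c d x y) (det²-* T U x)) (trans (second a b c d x y) (det²-* T U y))
  where
  first : ∀ a b c d x y → let e = a ℤ.* d ℤ.- b ℤ.* c in
    (e ℤ.* d) ℤ.* (a ℤ.* x ℤ.+ b ℤ.* y) ℤ.+ (ℤ.- (e ℤ.* b)) ℤ.* (c ℤ.* x ℤ.+ d ℤ.* y) ≡ (e ℤ.* e) ℤ.* x
  first = solveℤ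
  second : ∀ a b c d x y → let e = a ℤ.* d ℤ.- b ℤ.* c in
    (ℤ.- (e ℤ.* c)) ℤ.* (a ℤ.* x ℤ.+ b ℤ.* y) ℤ.+ (e ℤ.* a) ℤ.* (c ℤ.* x ℤ.+ d ℤ.* y) ≡ (e ℤ.* e) ℤ.* y
  second = solveℤ

inverse-actʳ : ∀ T → Unimodular T → ∀ w → act T (act (inverse T) w) ≡ w
inverse-actʳ T@(mat a b c d) U (x , y) =
  cong₂ _,_ (trans (first a b c d x y) (det²-* T U x)) (trans (second a b c d x y) (det²-* T U y))
  where
  first : ∀ a b c d x y → let e = a ℤ.* d ℤ.- b ℤ.* c in
    a ℤ.* ((e ℤ.* d) ℤ.* x ℤ.+ (ℤ.- (e ℤ.* b)) ℤ.* y) ℤ.+ b ℤ.* ((ℤ.- (e ℤ.* c)) ℤ.* x ℤ.+ (e ℤ.* a) ℤ.* y)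
    ≡ (e ℤ.* e) ℤ.* x
  first = solveℤ
  second : ∀ a b c d x y → let e = a ℤ.* d ℤ.- b ℤ.* c in
    c ℤ.* ((e ℤ.* d) ℤ.* x ℤ.+ (ℤ.- (e ℤ.* b)) ℤ.* y) ℤ.+ d ℤ.* ((ℤ.- (e ℤ.* c)) ℤ.* x ℤ.+ (e ℤ.* a) ℤ.* y)
    ≡ (e ℤ.* e) ℤ.* y
  second = solveℤ

act-InInterior : ∀ T u v w → InInterior u v (ι² w) → InInterior (act T u) (act T v) (ι² (act T w))
act-InInterior T u v w (t₁ , t₂ , b₁ , b₂ , e) = t₁ , t₂ , b₁ , b₂ , act-lin T u v w t₁ t₂ e

act-OnMainDiag : ∀ T u v w → OnMainDiag u v w → OnMainDiag (act T u) (act T v) (act T w)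
act-OnMainDiag T u v w (t , b , e) =
  t , b , subst₂ (λ s z → ι² (act T w) ≡ lin t (ι² s) 0ℚ (ι² z)) (act-+² T u v) (act-0² T) (act-lin T (u +² v) 0² w t 0ℚ e)

act-OnAntiDiag : ∀ T u v w → OnAntiDiag u v w → OnAntiDiag (act T u) (act T v) (act T w)
act-OnAntiDiag T u v w (t , b , e) = t , b , act-lin T u v w t (1ℚ ℚ.- t) e

act⇒MapsOnto : ∀ T u v p q → act T u ≡ p → act T v ≡ q → MapsOnto T u v p q
act⇒MapsOnto T u v p q Tu≡p Tv≡q x = mk⇔ to from
  where
  image : ∀ t₁ t₂ → apply T (lin t₁ (ι² u) t₂ (ι² v)) ≡ lin t₁ (ι² p) t₂ (ι² q)
  image t₁ t₂ = trans (apply-lin T t₁ (ι² u) t₂ (ι² v))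
    (cong₂ (λ p′ q′ → lin t₁ p′ t₂ q′) (trans (apply-ι² T u) (cong ι² Tu≡p)) (trans (apply-ι² T v) (cong ι² Tv≡q)))
  to : ∃[ y ] (InPar u v y × apply T y ≡ x) → InPar p q x
  to (y , (t₁ , t₂ , b₁ , b₂ , y≡) , Ty≡x) = t₁ , t₂ , b₁ , b₂ , trans (sym Ty≡x) (trans (cong (apply T) y≡) (image t₁ t₂))
  from : InPar p q x → ∃[ y ] (InPar u v y × apply T y ≡ x)
  from (t₁ , t₂ , b₁ , b₂ , x≡) = lin t₁ (ι² u) t₂ (ι² v) , (t₁ , t₂ , b₁ , b₂ , refl) , trans (image t₁ t₂) (sym x≡)

-- Invariance of V

gcd² : ℤ² → ℕ
gcd² (x , y) = gcd ∣ x ∣ ∣ y ∣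

gcd²∣gcd²-act : ∀ T w → gcd² w ℕD.∣ gcd² (act T w)
gcd²∣gcd²-act (mat a b c d) (x , y) = ℕG.gcd-greatest (ℤD.∣⇒∣ᵤ (combination a b)) (ℤD.∣⇒∣ᵤ (combination c d))
  where
  g∣x : + gcd² (x , y) ℤD.∣ x
  g∣x = ℤD.∣ᵤ⇒∣ (ℕG.gcd[m,n]∣m ∣ x ∣ ∣ y ∣)
  g∣y : + gcd² (x , y) ℤD.∣ y
  g∣y = ℤD.∣ᵤ⇒∣ (ℕG.gcd[m,n]∣n ∣ x ∣ ∣ y ∣)
  combination : ∀ a b → + gcd² (x , y) ℤD.∣ (a ℤ.* x ℤ.+ b ℤ.* y)
  combination a b = ℤD.∣m∣n⇒∣m+n (ℤD.∣n⇒∣m*n a g∣x) (ℤD.∣n⇒∣m*n b g∣y)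

Visible-act⁻ : ∀ T w → Visible (act T w) → Visible w
Visible-act⁻ T w vis = ℕD.∣1⇒≡1 (subst (gcd² w ℕD.∣_) vis (gcd²∣gcd²-act T w))

Visible-act : ∀ T → Unimodular T → ∀ w → Visible w → Visible (act T w)
Visible-act T U w vis = Visible-act⁻ (inverse T) (act T w) (subst Visible (sym (inverse-actˡ T U w)) vis)

HasCard-bijection : ∀ (S R : ℤ² → Set) (f g : ℤ² → ℤ²) {k} →
  (∀ w → g (f w) ≡ w) → (∀ w → f (g w) ≡ w) →
  (∀ w → S w → R (f w)) → (∀ w → R w → S (g w)) → HasCard S k → HasCard R k
HasCard-bijection S R f g gf fg S⇒R R⇒S (xs , unique , mem , len) =
  map f xs , UniqueP.map⁺ f-injective unique , (λ w → mk⇔ (to w) (from w)) , trans (ListP.length-map f xs) len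
  where
  f-injective : ∀ {x y} → f x ≡ f y → x ≡ y
  f-injective {x} {y} e = trans (sym (gf x)) (trans (cong g e) (gf y))
  to : ∀ w → w ∈ map f xs → R w
  to w w∈ with ∈P.∈-map⁻ f w∈
  ... | x , x∈ , refl = S⇒R x (Equivalence.to (mem x) x∈)
  from : ∀ w → R w → w ∈ map f xs
  from w Rw = subst (_∈ map f xs) (fg w) (∈P.∈-map⁺ f (Equivalence.from (mem (g w)) (R⇒S w Rw)))

private
  V≡-act⁺ : ∀ T → Unimodular T → ∀ u v {k} → V≡ u v k → V≡ (act T u) (act T v) k
  V≡-act⁺ T U u v = HasCard-bijection (VisInt u v) (VisInt (act T u) (act T v)) (act T) (act (inverse T))
    (inverse-actˡ T U) (inverse-actʳ T U)
    (λ w (int , vis) → act-InInterior T u v w int , Visible-act T U w vis)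
    (λ w (int , vis) → subst₂ (λ u′ v′ → InInterior u′ v′ (ι² (act (inverse T) w))) (inverse-actˡ T U u) (inverse-actˡ T U v)
                         (act-InInterior (inverse T) (act T u) (act T v) w int)
                     , Visible-act⁻ T (act (inverse T) w) (subst Visible (sym (inverse-actʳ T U w)) vis))

V≡-act : ∀ T → Unimodular T → ∀ u v {k} → V≡ u v k ⇔ V≡ (act T u) (act T v) k
V≡-act T U u v {k} = mk⇔ (V≡-act⁺ T U u v)
  (λ V → subst₂ (λ u′ v′ → V≡ u′ v′ k) (inverse-actˡ T U u) (inverse-actˡ T U v)
           (V≡-act⁺ (inverse T) (Unimodular-inverse T U) (act T u) (act T v) V))

lin-comm : ∀ t₁ x t₂ y → lin t₁ x t₂ y ≡ lin t₂ y t₁ x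
lin-comm t₁ (x₁ , x₂) t₂ (y₁ , y₂) = cong₂ _,_ (ℚP.+-comm (t₁ ℚ.* x₁) (t₂ ℚ.* y₁)) (ℚP.+-comm (t₁ ℚ.* x₂) (t₂ ℚ.* y₂))

InPar-swap : ∀ u v x → InPar u v x → InPar v u x
InPar-swap u v x (t₁ , t₂ , b₁ , b₂ , e) = t₂ , t₁ , b₂ , b₁ , trans e (lin-comm t₁ (ι² u) t₂ (ι² v))

InInterior-swap : ∀ u v x → InInterior u v x → InInterior v u x
InInterior-swap u v x (t₁ , t₂ , b₁ , b₂ , e) = t₂ , t₁ , b₂ , b₁ , trans e (lin-comm t₁ (ι² u) t₂ (ι² v))

V≡-swap : ∀ u v {k} → V≡ u v k → V≡ v u k
V≡-swap u v = HasCard-bijection (VisInt u v) (VisInt v u) (λ w → w) (λ w → w) (λ _ → refl) (λ _ → refl)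
  (λ w (int , vis) → InInterior-swap u v (ι² w) int , vis) (λ w (int , vis) → InInterior-swap v u (ι² w) int , vis)

-- Edges of a clean parallelogram are primitive

+²-comm : ∀ u v → u +² v ≡ v +² u
+²-comm (a , b) (c , d) = cong₂ _,_ (ℤP.+-comm a c) (ℤP.+-comm b d)

Clean-swap : ∀ u v → Clean u v → Clean v u
Clean-swap u v clean w (inP , notInt)
  with clean w (InPar-swap v u (ι² w) inP , λ int → notInt (InInterior-swap u v (ι² w) int))
... | inj₁ w≡0               = inj₁ w≡0
... | inj₂ (inj₁ w≡u)        = inj₂ (inj₂ (inj₁ w≡u))
... | inj₂ (inj₂ (inj₁ w≡v)) = inj₂ (inj₁ w≡v)
... | inj₂ (inj₂ (inj₂ w≡s)) = inj₂ (inj₂ (inj₂ (trans w≡s (+²-comm u v))))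

det-swap : ∀ u v → det v u ≡ ℤ.- det u v
det-swap (a , b) (c , d) = antisymmetric a b c d
  where
  antisymmetric : ∀ a b c d → c ℤ.* b ℤ.- d ℤ.* a ≡ ℤ.- (a ℤ.* d ℤ.- b ℤ.* c)
  antisymmetric = solveℤ

det-swap-≢0 : ∀ u v → det u v ≢ + 0 → det v u ≢ + 0
det-swap-≢0 u v det≢0 e = det≢0 (ℤP.neg-injective {j = + 0} (trans (sym (det-swap u v)) e))

infixl 7 _*²_
_*²_ : ℤ² → ℤ → ℤ²
(x , y) *² c = (x ℤ.* c , y ℤ.* c)

positive-*-cancel-0 : ∀ s x → 0ℚ ℚ.< s → 0ℚ ≡ s ℚ.* x → x ≡ 0ℚ
positive-*-cancel-0 s x 0<s e = begin
  x                      ≡⟨ sym (ℚP.*-identityˡ x) ⟩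
  1ℚ ℚ.* x               ≡⟨ cong (ℚ._* x) (sym (ℚP.*-inverseˡ s)) ⟩
  ℚ.1/ s ℚ.* s ℚ.* x     ≡⟨ ℚP.*-assoc (ℚ.1/ s) s x ⟩
  ℚ.1/ s ℚ.* (s ℚ.* x)   ≡⟨ cong (ℚ.1/ s ℚ.*_) (sym e) ⟩
  ℚ.1/ s ℚ.* 0ℚ          ≡⟨ ℚP.*-zeroʳ (ℚ.1/ s) ⟩
  0ℚ                     ∎
  where
  open ≡-Reasoning
  instance
    s≢0 : ℚ.NonZero s
    s≢0 = ℚP.pos⇒nonZero s {{ℚ.positive 0<s}}

-- w itself lies on the edge from 0 to w *² (2 + k) without being a vertex.
multiple-not-Clean : ∀ w v k → det (w *² + suc (suc k)) v ≢ + 0 → ¬ Clean (w *² + suc (suc k)) v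
multiple-not-Clean w@(w₁ , w₂) v@(v₁ , v₂) k det≢0 clean = not-a-vertex (clean w (w∈P , w∉P°))
  where
  open Fraction (suc k)
  G : ℤ
  G = + suc (suc k)
  u : ℤ²
  u = w *² G
  det-u : det u v ≡ G ℤ.* det w v
  det-u = homogeneous w₁ w₂ v₁ v₂ G
    where
    homogeneous : ∀ w₁ w₂ v₁ v₂ G → (w₁ ℤ.* G) ℤ.* v₂ ℤ.- (w₂ ℤ.* G) ℤ.* v₁ ≡ G ℤ.* (w₁ ℤ.* v₂ ℤ.- w₂ ℤ.* v₁)
    homogeneous = solveℤ
  det-uw : det u w ≡ + 0
  det-uw = parallel w₁ w₂ G
    where
    parallel : ∀ w₁ w₂ G → (w₁ ℤ.* G) ℤ.* w₂ ℤ.- (w₂ ℤ.* G) ℤ.* w₁ ≡ + 0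
    parallel = solveℤ
  on-edge : ∀ z z′ → ι z ≡ frac (+ 1) ℚ.* ι (z ℤ.* G) ℚ.+ 0ℚ ℚ.* ι z′
  on-edge z z′ = begin
    ι z                                     ≡⟨ sym (ℚP.*-identityʳ (ι z)) ⟩
    ι z ℚ.* 1ℚ                              ≡⟨ cong (ι z ℚ.*_) (sym (frac-*-denominator (+ 1))) ⟩
    ι z ℚ.* (frac (+ 1) ℚ.* ι G)            ≡⟨ regroup (ι z) (frac (+ 1)) (ι G) (ι z′) ⟩
    frac (+ 1) ℚ.* (ι z ℚ.* ι G) ℚ.+ 0ℚ ℚ.* ι z′ ≡⟨ cong (λ x → frac (+ 1) ℚ.* x ℚ.+ 0ℚ ℚ.* ι z′) (sym (ι-* z G)) ⟩
    frac (+ 1) ℚ.* ι (z ℤ.* G) ℚ.+ 0ℚ ℚ.* ι z′ ∎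
    where
    open ≡-Reasoning
    regroup : ∀ z t g z′ → z ℚ.* (t ℚ.* g) ≡ t ℚ.* (z ℚ.* g) ℚ.+ 0ℚ ℚ.* z′
    regroup = solve-∀ ℚ-ring
  w∈P : InPar u v (ι² w)
  w∈P = frac (+ 1) , 0ℚ , (frac-nonNeg {+ 1} (ℤ.+≤+ z≤n) , frac≤1 {+ 1} (ℤ.+≤+ (s≤s z≤n))) ,
        (ℚP.≤-refl , ℚ.*≤* (ℤ.+≤+ z≤n)) , cong₂ _,_ (on-edge w₁ v₁) (on-edge w₂ v₂)
  w∉P° : ¬ InInterior u v (ι² w)
  w∉P° (s₁ , s₂ , _ , (0<s₂ , _) , e) = det≢0 (ι-injective (positive-*-cancel-0 s₂ (ι (det u v)) 0<s₂
    (trans (cong ι (sym det-uw)) (proj₂ (cramer u v w s₁ s₂ e)))))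
  det-w≢0 : det w v ≢ + 0
  det-w≢0 e = det≢0 (trans det-u (trans (cong (G ℤ.*_) e) (ℤP.*-zeroʳ G)))
  not-one : det w v ≢ G ℤ.* det w v
  not-one e with ℤP.*-cancelʳ-≡ (+ 1) G (det w v) {{ℤ.≢-nonZero det-w≢0}} (trans (ℤP.*-identityˡ (det w v)) e)
  ... | ()
  not-a-vertex : ¬ (w ≡ 0² ⊎ w ≡ u ⊎ w ≡ v ⊎ w ≡ u +² v)
  not-a-vertex (inj₁ refl) = det-w≢0 (zero-det v₁ v₂)
    where
    zero-det : ∀ v₁ v₂ → + 0 ℤ.* v₂ ℤ.- + 0 ℤ.* v₁ ≡ + 0
    zero-det = solveℤ
  not-a-vertex (inj₂ (inj₁ w≡u)) = not-one (trans (cong (λ x → det x v) w≡u) det-u)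
  not-a-vertex (inj₂ (inj₂ (inj₁ refl))) = det-w≢0 (self-det v₁ v₂)
    where
    self-det : ∀ v₁ v₂ → v₁ ℤ.* v₂ ℤ.- v₂ ℤ.* v₁ ≡ + 0
    self-det = solveℤ
  not-a-vertex (inj₂ (inj₂ (inj₂ w≡u+v))) =
    not-one (trans (cong (λ x → det x v) w≡u+v) (trans (shear (w₁ ℤ.* G) (w₂ ℤ.* G) v₁ v₂) det-u))
    where
    shear : ∀ a b v₁ v₂ → (a ℤ.+ v₁) ℤ.* v₂ ℤ.- (b ℤ.+ v₂) ℤ.* v₁ ≡ a ℤ.* v₂ ℤ.- b ℤ.* v₁
    shear = solveℤ

Clean⇒Visible : ∀ u v → det u v ≢ + 0 → Clean u v → Visible u
Clean⇒Visible u@(u₁ , u₂) v det≢0 clean with gcd² u in g≡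
... | 1 = refl
... | 0 = ⊥-elim (det≢0 (trans (cong (λ x → det x v) u≡0) (zero-det (proj₁ v) (proj₂ v))))
  where
  u≡0 : u ≡ 0²
  u≡0 = cong₂ _,_ (ℤP.∣i∣≡0⇒i≡0 (ℕG.gcd[m,n]≡0⇒m≡0 g≡)) (ℤP.∣i∣≡0⇒i≡0 (ℕG.gcd[m,n]≡0⇒n≡0 ∣ u₁ ∣ g≡))
  zero-det : ∀ v₁ v₂ → + 0 ℤ.* v₂ ℤ.- + 0 ℤ.* v₁ ≡ + 0
  zero-det = solveℤ
... | suc (suc k)
  with ℤD.∣ᵤ⇒∣ {+ suc (suc k)} {u₁} (subst (ℕD._∣ ∣ u₁ ∣) g≡ (ℕG.gcd[m,n]∣m ∣ u₁ ∣ ∣ u₂ ∣))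
     | ℤD.∣ᵤ⇒∣ {+ suc (suc k)} {u₂} (subst (ℕD._∣ ∣ u₂ ∣) g≡ (ℕG.gcd[m,n]∣n ∣ u₁ ∣ ∣ u₂ ∣))
... | ℤD.divides w₁ refl | ℤD.divides w₂ refl = ⊥-elim (multiple-not-Clean (w₁ , w₂) v k det≢0 clean)

-- A unimodular normal form

unit-sign : ∀ z → ∃[ s ] (s ℤ.* z ≡ + ∣ z ∣ × s ≡± + 1)
unit-sign (+ k)    = + 1 , ℤP.*-identityˡ (+ k) , inj₁ refl
unit-sign -[1+ k ] = ℤ.- + 1 , ℤP.-1*i≡-i -[1+ k ] , inj₂ refl

private
  bézout-+- : ∀ a b x y → 1 ℕ.+ y ℕ.* ∣ b ∣ ≡ x ℕ.* ∣ a ∣ → ∃[ X ] ∃[ Y ] (X ℤ.* a ℤ.+ Y ℤ.* b ≡ + 1)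
  bézout-+- a b x y eq with unit-sign a | unit-sign b
  ... | sa , sa*a≡∣a∣ , _ | sb , sb*b≡∣b∣ , _ = + x ℤ.* sa , ℤ.- (+ y ℤ.* sb) , (begin
    (+ x ℤ.* sa) ℤ.* a ℤ.+ (ℤ.- (+ y ℤ.* sb)) ℤ.* b ≡⟨ regroup (+ x) sa a (+ y) sb b ⟩
    + x ℤ.* (sa ℤ.* a) ℤ.- + y ℤ.* (sb ℤ.* b)       ≡⟨ cong₂ (λ p q → + x ℤ.* p ℤ.- + y ℤ.* q) sa*a≡∣a∣ sb*b≡∣b∣ ⟩
    + x ℤ.* + ∣ a ∣ ℤ.- + y ℤ.* + ∣ b ∣             ≡⟨ cong₂ ℤ._-_ (sym (ℤP.pos-* x ∣ a ∣)) (sym (ℤP.pos-* y ∣ b ∣)) ⟩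
    + (x ℕ.* ∣ a ∣) ℤ.- + (y ℕ.* ∣ b ∣)             ≡⟨ cong (λ n → + n ℤ.- + (y ℕ.* ∣ b ∣)) (sym eq) ⟩
    + (1 ℕ.+ y ℕ.* ∣ b ∣) ℤ.- + (y ℕ.* ∣ b ∣)       ≡⟨ cancel (+ (y ℕ.* ∣ b ∣)) ⟩
    + 1                                             ∎)
    where
    open ≡-Reasoning
    regroup : ∀ X S A Y S′ B → (X ℤ.* S) ℤ.* A ℤ.+ (ℤ.- (Y ℤ.* S′)) ℤ.* B ≡ X ℤ.* (S ℤ.* A) ℤ.- Y ℤ.* (S′ ℤ.* B)
    regroup = solveℤ
    cancel : ∀ Z → (+ 1 ℤ.+ Z) ℤ.- Z ≡ + 1
    cancel = solveℤ

bézout : ∀ a b → gcd ∣ a ∣ ∣ b ∣ ≡ 1 → ∃[ X ] ∃[ Y ] (X ℤ.* a ℤ.+ Y ℤ.* b ≡ + 1)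
bézout a b g≡1 with ℕG.Bézout.identity (subst (ℕG.GCD ∣ a ∣ ∣ b ∣) g≡1 (ℕG.gcd-GCD ∣ a ∣ ∣ b ∣))
... | ℕG.Bézout.+- x y eq = bézout-+- a b x y eq
... | ℕG.Bézout.-+ x y eq with bézout-+- b a y x eq
...   | Y , X , e = X , Y , trans (ℤP.+-comm (X ℤ.* a) (Y ℤ.* b)) e

coprime⇒pos : ∀ a m → gcd a (suc (suc m)) ≡ 1 → 1 ≤ a
coprime⇒pos zero m e with trans (sym (ℕG.gcd-identityˡ (suc (suc m)))) e
... | ()
coprime⇒pos (suc a) m _ = s≤s z≤n

NormalForm : ℤ² → ℤ² → ℕ → Set
NormalForm u v n = ∃[ T ] ∃[ a ] (Unimodular T × 1 ≤ a × a < n × gcd a n ≡ 1 × act T u ≡ e₁ × act T v ≡ (+ a , + n))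

-- The first row of T is a Bézout row for u and the second is ±(-u₂ , u₁), so T u = e₁ and
-- det T = ±1; adding a multiple of the second row to the first reduces T v modulo n.
normal-form : ∀ u v m → Visible u → Visible v → area u v ≡ suc (suc m) → NormalForm u v (suc (suc m))
normal-form (u₁ , u₂) (v₁ , v₂) m vis-u vis-v ∣D∣≡n
  with unit-sign (det (u₁ , u₂) (v₁ , v₂)) | bézout u₁ u₂ vis-u
... | ε , εD≡∣D∣ , ε-unit | X , Y , XY≡1 =
  T , a , T-unimodular , coprime⇒pos a m a-coprime , ℤDM.n%ℕd<d b n , a-coprime , Tu≡e₁ , Tv≡[a,n]
  where
  n : ℕ
  n = suc (suc m)
  εD≡n : ε ℤ.* (u₁ ℤ.* v₂ ℤ.- u₂ ℤ.* v₁) ≡ + n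
  εD≡n = trans εD≡∣D∣ (cong +_ ∣D∣≡n)
  b k : ℤ
  b = X ℤ.* v₁ ℤ.+ Y ℤ.* v₂
  k = b ℤDM./ℕ n
  a : ℕ
  a = b ℤDM.%ℕ n
  T : Mat2
  T = mat (X ℤ.+ k ℤ.* ε ℤ.* u₂) (Y ℤ.- k ℤ.* ε ℤ.* u₁) (ℤ.- (ε ℤ.* u₂)) (ε ℤ.* u₁)
  T-unimodular : Unimodular T
  T-unimodular = subst (_≡± + 1) (sym (trans (det-T X Y k ε u₁ u₂) (trans (cong (ε ℤ.*_) XY≡1) (ℤP.*-identityʳ ε)))) ε-unit
    where
    det-T : ∀ X Y k ε u₁ u₂ → (X ℤ.+ k ℤ.* ε ℤ.* u₂) ℤ.* (ε ℤ.* u₁) ℤ.- (Y ℤ.- k ℤ.* ε ℤ.* u₁) ℤ.* (ℤ.- (ε ℤ.* u₂))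
      ≡ ε ℤ.* (X ℤ.* u₁ ℤ.+ Y ℤ.* u₂)
    det-T = solveℤ
  Tu≡e₁ : act T (u₁ , u₂) ≡ e₁
  Tu≡e₁ = cong₂ _,_ (trans (first X Y k ε u₁ u₂) XY≡1) (second ε u₁ u₂)
    where
    first : ∀ X Y k ε u₁ u₂ → (X ℤ.+ k ℤ.* ε ℤ.* u₂) ℤ.* u₁ ℤ.+ (Y ℤ.- k ℤ.* ε ℤ.* u₁) ℤ.* u₂ ≡ X ℤ.* u₁ ℤ.+ Y ℤ.* u₂
    first = solveℤ
    second : ∀ ε u₁ u₂ → (ℤ.- (ε ℤ.* u₂)) ℤ.* u₁ ℤ.+ (ε ℤ.* u₁) ℤ.* u₂ ≡ + 0
    second = solveℤ
  Tv≡[a,n] : act T (v₁ , v₂) ≡ (+ a , + n)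
  Tv≡[a,n] = cong₂ _,_ (begin
      (X ℤ.+ k ℤ.* ε ℤ.* u₂) ℤ.* v₁ ℤ.+ (Y ℤ.- k ℤ.* ε ℤ.* u₁) ℤ.* v₂ ≡⟨ first X Y k ε u₁ u₂ v₁ v₂ ⟩
      b ℤ.- k ℤ.* (ε ℤ.* (u₁ ℤ.* v₂ ℤ.- u₂ ℤ.* v₁))                  ≡⟨ cong (λ z → b ℤ.- k ℤ.* z) εD≡n ⟩
      b ℤ.- k ℤ.* + n                                                 ≡⟨ cong (ℤ._- k ℤ.* + n) (ℤDM.a≡a%ℕn+[a/ℕn]*n b n) ⟩
      (+ a ℤ.+ k ℤ.* + n) ℤ.- k ℤ.* + n                               ≡⟨ cancel (+ a) (k ℤ.* + n) ⟩
      + a                                                             ∎)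
    (trans (second ε u₁ u₂ v₁ v₂) εD≡n)
    where
    open ≡-Reasoning
    first : ∀ X Y k ε u₁ u₂ v₁ v₂ → (X ℤ.+ k ℤ.* ε ℤ.* u₂) ℤ.* v₁ ℤ.+ (Y ℤ.- k ℤ.* ε ℤ.* u₁) ℤ.* v₂
       ≡ (X ℤ.* v₁ ℤ.+ Y ℤ.* v₂) ℤ.- k ℤ.* (ε ℤ.* (u₁ ℤ.* v₂ ℤ.- u₂ ℤ.* v₁))
    first = solveℤ
    second : ∀ ε u₁ u₂ v₁ v₂ → (ℤ.- (ε ℤ.* u₂)) ℤ.* v₁ ℤ.+ (ε ℤ.* u₁) ℤ.* v₂ ≡ ε ℤ.* (u₁ ℤ.* v₂ ℤ.- u₂ ℤ.* v₁)
    second = solveℤ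
    cancel : ∀ A K → (A ℤ.+ K) ℤ.- K ≡ A
    cancel = solveℤ
  a-coprime : gcd a n ≡ 1
  a-coprime = subst Visible Tv≡[a,n] (Visible-act T T-unimodular (v₁ , v₂) vis-v)

-- A basis inside a parallelogram of the same area consists of its edges

extremal-product : ∀ n A₁ A₂ B₁ B₂ → A₁ ℕ.+ A₂ ≤ suc n → B₁ ℕ.+ B₂ ≤ suc n →
  A₁ ℕ.* B₂ ≡ suc n ℕ.* suc n ℕ.+ A₂ ℕ.* B₁ → (A₁ ≡ suc n) × (A₂ ≡ 0) × (B₁ ≡ 0) × (B₂ ≡ suc n)
extremal-product n A₁ A₂ B₁ B₂ A≤ B≤ e = A₁≡N , A₂≡0 , B₁≡0 , B₂≡N
  where
  N : ℕ
  N = suc n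
  N*N≤A₁*B₂ : N ℕ.* N ≤ A₁ ℕ.* B₂
  N*N≤A₁*B₂ = subst (N ℕ.* N ≤_) (sym e) (ℕP.m≤m+n (N ℕ.* N) (A₂ ℕ.* B₁))
  B₂≤N : B₂ ≤ N
  B₂≤N = ℕP.≤-trans (ℕP.m≤n+m B₂ B₁) B≤
  A₁≡N : A₁ ≡ N
  A₁≡N = ℕP.≤-antisym (ℕP.≤-trans (ℕP.m≤m+n A₁ A₂) A≤) (ℕP.≮⇒≥ λ A₁<N →
    ℕP.<-irrefl refl (ℕP.≤-<-trans N*N≤A₁*B₂ (ℕP.≤-<-trans (ℕP.*-monoʳ-≤ A₁ B₂≤N) (ℕP.*-monoˡ-< N A₁<N))))
  B₂≡N : B₂ ≡ N
  B₂≡N = ℕP.≤-antisym B₂≤N (ℕP.*-cancelˡ-≤ N (subst (λ z → N ℕ.* N ≤ z ℕ.* B₂) A₁≡N N*N≤A₁*B₂))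
  A₂≡0 : A₂ ≡ 0
  A₂≡0 = ℕP.n≤0⇒n≡0 (ℕP.+-cancelˡ-≤ N A₂ 0 (subst₂ _≤_ (cong (ℕ._+ A₂) A₁≡N) (sym (ℕP.+-identityʳ N)) A≤))
  B₁≡0 : B₁ ≡ 0
  B₁≡0 = ℕP.n≤0⇒n≡0 (ℕP.+-cancelʳ-≤ N B₁ 0 (subst (λ z → B₁ ℕ.+ z ≤ N) B₂≡N B≤))

i-j+j≡i : ∀ i j → i ℤ.- j ℤ.+ j ≡ i
i-j+j≡i = solveℤ

extremal-productℤ : ∀ n α₁ α₂ β₁ β₂ → + 0 ℤ.≤ α₁ → + 0 ℤ.≤ α₂ → + 0 ℤ.≤ β₁ → + 0 ℤ.≤ β₂ →
  α₁ ℤ.+ α₂ ℤ.≤ + suc n → β₁ ℤ.+ β₂ ℤ.≤ + suc n → α₁ ℤ.* β₂ ℤ.- α₂ ℤ.* β₁ ≡ + suc n ℤ.* + suc n →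
  (α₁ ≡ + suc n) × (α₂ ≡ + 0) × (β₁ ≡ + 0) × (β₂ ≡ + suc n)
extremal-productℤ n (+ A₁) (+ A₂) (+ B₁) (+ B₂) _ _ _ _ α≤ β≤ e
  with extremal-product n A₁ A₂ B₁ B₂ (ℤP.drop‿+≤+ α≤) (ℤP.drop‿+≤+ β≤) (ℤP.+-injective (begin
    + (A₁ ℕ.* B₂)                                     ≡⟨ ℤP.pos-* A₁ B₂ ⟩
    + A₁ ℤ.* + B₂                                     ≡⟨ sym (i-j+j≡i (+ A₁ ℤ.* + B₂) (+ A₂ ℤ.* + B₁)) ⟩
    (+ A₁ ℤ.* + B₂ ℤ.- + A₂ ℤ.* + B₁) ℤ.+ + A₂ ℤ.* + B₁ ≡⟨ cong₂ ℤ._+_ e (sym (ℤP.pos-* A₂ B₁)) ⟩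
    + suc n ℤ.* + suc n ℤ.+ + (A₂ ℕ.* B₁)               ≡⟨ cong (ℤ._+ + (A₂ ℕ.* B₁)) (sym (ℤP.pos-* (suc n) (suc n))) ⟩
    + (suc n ℕ.* suc n ℕ.+ A₂ ℕ.* B₁)                   ∎))
  where
  open ≡-Reasoning
... | refl , refl , refl , refl = refl , refl , refl , refl

det-+²ˡ : ∀ w₁ w₂ q → det (w₁ +² w₂) q ≡ det w₁ q ℤ.+ det w₂ q
det-+²ˡ (x₁ , y₁) (x₂ , y₂) (q₁ , q₂) = additive x₁ y₁ x₂ y₂ q₁ q₂
  where
  additive : ∀ x₁ y₁ x₂ y₂ q₁ q₂ →
    (x₁ ℤ.+ x₂) ℤ.* q₂ ℤ.- (y₁ ℤ.+ y₂) ℤ.* q₁ ≡ (x₁ ℤ.* q₂ ℤ.- y₁ ℤ.* q₁) ℤ.+ (x₂ ℤ.* q₂ ℤ.- y₂ ℤ.* q₁)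
  additive = solveℤ

det-+²ʳ : ∀ p w₁ w₂ → det p (w₁ +² w₂) ≡ det p w₁ ℤ.+ det p w₂
det-+²ʳ (p₁ , p₂) (x₁ , y₁) (x₂ , y₂) = additive p₁ p₂ x₁ y₁ x₂ y₂
  where
  additive : ∀ p₁ p₂ x₁ y₁ x₂ y₂ →
    p₁ ℤ.* (y₁ ℤ.+ y₂) ℤ.- p₂ ℤ.* (x₁ ℤ.+ x₂) ≡ (p₁ ℤ.* y₁ ℤ.- p₂ ℤ.* x₁) ℤ.+ (p₁ ℤ.* y₂ ℤ.- p₂ ℤ.* x₂)
  additive = solveℤ

det-of-coordinates : ∀ p q w₁ w₂ → det w₁ q ℤ.* det p w₂ ℤ.- det w₂ q ℤ.* det p w₁ ≡ det p q ℤ.* det w₁ w₂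
det-of-coordinates (p₁ , p₂) (q₁ , q₂) (x₁ , y₁) (x₂ , y₂) = binet p₁ p₂ q₁ q₂ x₁ y₁ x₂ y₂
  where
  binet : ∀ p₁ p₂ q₁ q₂ x₁ y₁ x₂ y₂ →
    (x₁ ℤ.* q₂ ℤ.- y₁ ℤ.* q₁) ℤ.* (p₁ ℤ.* y₂ ℤ.- p₂ ℤ.* x₂) ℤ.- (x₂ ℤ.* q₂ ℤ.- y₂ ℤ.* q₁) ℤ.* (p₁ ℤ.* y₁ ℤ.- p₂ ℤ.* x₁)
    ≡ (p₁ ℤ.* q₂ ℤ.- p₂ ℤ.* q₁) ℤ.* (x₁ ℤ.* y₂ ℤ.- y₁ ℤ.* x₂)
  binet = solveℤ

module ParallelogramEdges (p q : ℤ²) (m : ℕ) (det≡ : det p q ≡ + suc m) where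
  open Parallelogram p q m det≡

  private
    cancel-det : ∀ z a b α β → z ℤ.* det p q ≡ α ℤ.* a ℤ.+ β ℤ.* b → α ≡ + suc m → β ≡ + 0 → z ≡ a
    cancel-det z a b α β e refl refl = ℤP.*-cancelʳ-≡ z a (+ suc m) (begin
      z ℤ.* + suc m                      ≡⟨ cong (z ℤ.*_) (sym det≡) ⟩
      z ℤ.* det p q                      ≡⟨ e ⟩
      + suc m ℤ.* a ℤ.+ + 0 ℤ.* b        ≡⟨ simplify (+ suc m) a b ⟩
      a ℤ.* + suc m                      ∎)
      where
      open ≡-Reasoning
      simplify : ∀ N a b → N ℤ.* a ℤ.+ + 0 ℤ.* b ≡ a ℤ.* N
      simplify = solveℤ

  ≡p : ∀ w → det w q ≡ + suc m → det p w ≡ + 0 → w ≡ p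
  ≡p w α≡N β≡0 = cong₂ _,_
    (cancel-det (proj₁ w) (proj₁ p) (proj₁ q) (det w q) (det p w) (proj₁ (det-expansion p q w)) α≡N β≡0)
    (cancel-det (proj₂ w) (proj₂ p) (proj₂ q) (det w q) (det p w) (proj₂ (det-expansion p q w)) α≡N β≡0)

  ≡q : ∀ w → det w q ≡ + 0 → det p w ≡ + suc m → w ≡ q
  ≡q w α≡0 β≡N = cong₂ _,_
    (cancel-det (proj₁ w) (proj₁ q) (proj₁ p) (det p w) (det w q)
      (trans (proj₁ (det-expansion p q w)) (ℤP.+-comm (det w q ℤ.* proj₁ p) _)) β≡N α≡0)
    (cancel-det (proj₂ w) (proj₂ q) (proj₂ p) (det p w) (det w q)
      (trans (proj₂ (det-expansion p q w)) (ℤP.+-comm (det w q ℤ.* proj₂ p) _)) β≡N α≡0)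

  edges-of-basis : ∀ w₁ w₂ → InPar p q (ι² w₁) → InPar p q (ι² w₂) → InPar p q (ι² (w₁ +² w₂)) →
    det w₁ w₂ ≡ + suc m → w₁ ≡ p × w₂ ≡ q
  edges-of-basis w₁ w₂ in₁ in₂ in₁₂ det≡N =
    from-bounds (InPar⇒det-bounds w₁ in₁) (InPar⇒det-bounds w₂ in₂) (InPar⇒det-bounds (w₁ +² w₂) in₁₂)
    where
    from-extremal : (det w₁ q ≡ + suc m) × (det w₂ q ≡ + 0) × (det p w₁ ≡ + 0) × (det p w₂ ≡ + suc m) →
      w₁ ≡ p × w₂ ≡ q
    from-extremal (α₁≡N , α₂≡0 , β₁≡0 , β₂≡N) = ≡p w₁ α₁≡N β₁≡0 , ≡q w₂ α₂≡0 β₂≡N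
    from-bounds : DetBounds w₁ → DetBounds w₂ → DetBounds (w₁ +² w₂) → w₁ ≡ p × w₂ ≡ q
    from-bounds ((0≤α₁ , _) , (0≤β₁ , _)) ((0≤α₂ , _) , (0≤β₂ , _)) ((_ , α≤N) , (_ , β≤N)) =
      from-extremal (extremal-productℤ m (det w₁ q) (det w₂ q) (det p w₁) (det p w₂) 0≤α₁ 0≤α₂ 0≤β₁ 0≤β₂
        (subst (ℤ._≤ + suc m) (det-+²ˡ w₁ w₂ q) α≤N) (subst (ℤ._≤ + suc m) (det-+²ʳ p w₁ w₂) β≤N)
        (trans (det-of-coordinates p q w₁ w₂) (cong₂ ℤ._*_ det≡ det≡N)))

  edges-of-basis± : ∀ w₁ w₂ → InPar p q (ι² w₁) → InPar p q (ι² w₂) → InPar p q (ι² (w₁ +² w₂)) →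
    det w₁ w₂ ≡± + suc m → (w₁ ≡ p × w₂ ≡ q) ⊎ (w₁ ≡ q × w₂ ≡ p)
  edges-of-basis± w₁ w₂ in₁ in₂ in₁₂ (inj₁ det≡N) = inj₁ (edges-of-basis w₁ w₂ in₁ in₂ in₁₂ det≡N)
  edges-of-basis± w₁ w₂ in₁ in₂ in₁₂ (inj₂ det≡-N) = inj₂ (swap (edges-of-basis w₂ w₁ in₂ in₁ in₂₁ det₂₁≡N))
    where
    in₂₁ : InPar p q (ι² (w₂ +² w₁))
    in₂₁ = subst (λ w → InPar p q (ι² w)) (+²-comm w₁ w₂) in₁₂
    det₂₁≡N : det w₂ w₁ ≡ + suc m
    det₂₁≡N = trans (det-swap w₁ w₂) (cong ℤ.-_ det≡-N)

∣i∣≡n⇒i≡±n : ∀ i n → ∣ i ∣ ≡ n → i ≡± + n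
∣i∣≡n⇒i≡±n (+ k)    .k        refl = inj₁ refl
∣i∣≡n⇒i≡±n -[1+ k ] .(suc k) refl = inj₂ refl

unit-*-≡± : ∀ {s i} n → s ≡± + 1 → i ≡± n → s ℤ.* i ≡± n
unit-*-≡± n (inj₁ refl) (inj₁ refl) = inj₁ (ℤP.*-identityˡ n)
unit-*-≡± n (inj₁ refl) (inj₂ refl) = inj₂ (ℤP.*-identityˡ (ℤ.- n))
unit-*-≡± n (inj₂ refl) (inj₁ refl) = inj₂ (ℤP.-1*i≡-i n)
unit-*-≡± n (inj₂ refl) (inj₂ refl) = inj₁ (trans (ℤP.-1*i≡-i (ℤ.- n)) (ℤP.neg-involutive n))

0≤1 : 0ℚ ℚ.≤ 1ℚ
0≤1 = ℚ.*≤* (ℤ.+≤+ z≤n)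

u∈P : ∀ u v → InPar u v (ι² u)
u∈P (u₁ , u₂) (v₁ , v₂) =
  1ℚ , 0ℚ , (0≤1 , ℚP.≤-refl) , (ℚP.≤-refl , 0≤1) , cong₂ _,_ (first (ι u₁) (ι v₁)) (first (ι u₂) (ι v₂))
  where
  first : ∀ x y → x ≡ 1ℚ ℚ.* x ℚ.+ 0ℚ ℚ.* y
  first = solve-∀ ℚ-ring

v∈P : ∀ u v → InPar u v (ι² v)
v∈P (u₁ , u₂) (v₁ , v₂) =
  0ℚ , 1ℚ , (ℚP.≤-refl , 0≤1) , (0≤1 , ℚP.≤-refl) , cong₂ _,_ (second (ι u₁) (ι v₁)) (second (ι u₂) (ι v₂))
  where
  second : ∀ x y → y ≡ 0ℚ ℚ.* x ℚ.+ 1ℚ ℚ.* y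
  second = solve-∀ ℚ-ring

u+v∈P : ∀ u v → InPar u v (ι² (u +² v))
u+v∈P (u₁ , u₂) (v₁ , v₂) = 1ℚ , 1ℚ , (0≤1 , ℚP.≤-refl) , (0≤1 , ℚP.≤-refl) ,
  cong₂ _,_ (trans (ι-+ u₁ v₁) (sum (ι u₁) (ι v₁))) (trans (ι-+ u₂ v₂) (sum (ι u₂) (ι v₂)))
  where
  sum : ∀ x y → x ℚ.+ y ≡ 1ℚ ℚ.* x ℚ.+ 1ℚ ℚ.* y
  sum = solve-∀ ℚ-ring

det-e₁ : ∀ x y → det e₁ (x , y) ≡ y
det-e₁ x y = second-coordinate x y
  where
  second-coordinate : ∀ x y → + 1 ℤ.* y ℤ.- + 0 ℤ.* x ≡ y
  second-coordinate = solveℤ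

MapsOnto⇒edges : ∀ T u v a m → Unimodular T → MapsOnto T u v e₁ (+ a , + suc m) → area u v ≡ suc m →
  (act T u ≡ e₁ × act T v ≡ (+ a , + suc m)) ⊎ (act T u ≡ (+ a , + suc m) × act T v ≡ e₁)
MapsOnto⇒edges T u v a m U onto area≡ =
  edges-of-basis± (act T u) (act T v) (image u (u∈P u v)) (image v (v∈P u v))
    (subst (λ w → InPar e₁ q (ι² w)) (act-+² T u v) (image (u +² v) (u+v∈P u v)))
    (subst (_≡± + suc m) (sym (det-act T u v)) (unit-*-≡± (+ suc m) U (∣i∣≡n⇒i≡±n (det u v) (suc m) area≡)))
  where
  q : ℤ²
  q = (+ a , + suc m)
  open ParallelogramEdges e₁ q m (det-e₁ (+ a) (+ suc m))
  image : ∀ w → InPar u v (ι² w) → InPar e₁ q (ι² (act T w))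
  image w w∈P = Equivalence.to (onto (ι² (act T w))) (ι² w , w∈P , apply-ι² T w)

-- Interior lattice points of P_{a,n}

j<i⇒0<i-j : ∀ {i j} → j ℤ.< i → + 0 ℤ.< i ℤ.- j
j<i⇒0<i-j {i} {j} j<i = subst (ℤ._< i ℤ.- j) (ℤP.+-inverseʳ j) (ℤP.+-monoˡ-< (ℤ.- j) j<i)

0<i-j⇒j<i : ∀ {i j} → + 0 ℤ.< i ℤ.- j → j ℤ.< i
0<i-j⇒j<i {i} {j} 0<i-j = subst₂ ℤ._<_ (ℤP.+-identityˡ j) (i-j+j≡i i j) (ℤP.+-monoˡ-< j 0<i-j)

i<j+k⇒i-j<k : ∀ {i j k} → i ℤ.< j ℤ.+ k → i ℤ.- j ℤ.< k
i<j+k⇒i-j<k {i} {j} {k} i<j+k = subst (i ℤ.- j ℤ.<_) (plus-minus j k) (ℤP.+-monoˡ-< (ℤ.- j) i<j+k)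
  where
  plus-minus : ∀ j k → (j ℤ.+ k) ℤ.- j ≡ k
  plus-minus = solveℤ

i-j<k⇒i<j+k : ∀ {i j k} → i ℤ.- j ℤ.< k → i ℤ.< j ℤ.+ k
i-j<k⇒i<j+k {i} {j} {k} i-j<k = subst₂ ℤ._<_ (i-j+j≡i i j) (ℤP.+-comm k j) (ℤP.+-monoˡ-< j i-j<k)

multiple-in-window-unique : ∀ n {c x x′} → c ℤ.< x ℤ.* + suc n → x ℤ.* + suc n ℤ.< c ℤ.+ + suc n →
  c ℤ.< x′ ℤ.* + suc n → x′ ℤ.* + suc n ℤ.< c ℤ.+ + suc n → x ≡ x′
multiple-in-window-unique n {c} {x} {x′} c<xN xN<c+N c<x′N x′N<c+N =
  ℤP.≤-antisym (ℤP.≮⇒≥ (not-below c<x′N xN<c+N)) (ℤP.≮⇒≥ (not-below c<xN x′N<c+N))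
  where
  N : ℤ
  N = + suc n
  not-below : ∀ {y y′} → c ℤ.< y ℤ.* N → y′ ℤ.* N ℤ.< c ℤ.+ N → ¬ (y ℤ.< y′)
  not-below {y} {y′} c<yN y′N<c+N y<y′ = ℤP.<-irrefl refl (begin-strict
    y′ ℤ.* N          <⟨ y′N<c+N ⟩
    c ℤ.+ N           <⟨ ℤP.+-monoˡ-< N c<yN ⟩
    y ℤ.* N ℤ.+ N     ≡⟨ next-multiple y N ⟩
    ℤ.suc y ℤ.* N     ≤⟨ ℤP.*-monoʳ-≤-nonNeg N (ℤP.i<j⇒suc[i]≤j y<y′) ⟩
    y′ ℤ.* N          ∎)
    where
    open ℤP.≤-Reasoning
    next-multiple : ∀ y N → y ℤ.* N ℤ.+ N ≡ (+ 1 ℤ.+ y) ℤ.* N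
    next-multiple = solveℤ

-- P_{a,n} with n = 1 + m
module Standard (m a : ℕ) where
  N : ℤ
  N = + suc m
  q : ℤ²
  q = (+ a , N)
  open Parallelogram e₁ q m (det-e₁ (+ a) N)

  Window : ℤ → ℤ → Set
  Window x y = (y ℤ.* + a ℤ.< x ℤ.* N) × (x ℤ.* N ℤ.< y ℤ.* + a ℤ.+ N)

  InInterior⇒window : ∀ x y → InInterior e₁ q (ι² (x , y)) → Window x y × (+ 0 ℤ.< y) × (y ℤ.< N)
  InInterior⇒window x y int = from-bounds (InInterior⇒det-bounds (x , y) int)
    where
    from-bounds : ((+ 0 ℤ.< det (x , y) q) × (det (x , y) q ℤ.< N)) × ((+ 0 ℤ.< det e₁ (x , y)) × (det e₁ (x , y) ℤ.< N)) →
      Window x y × (+ 0 ℤ.< y) × (y ℤ.< N)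
    from-bounds ((0<α , α<N) , (0<β , β<N)) =
      (0<i-j⇒j<i 0<α , i-j<k⇒i<j+k α<N) , subst (+ 0 ℤ.<_) (det-e₁ x y) 0<β , subst (ℤ._< N) (det-e₁ x y) β<N

  window⇒InInterior : ∀ x y → Window x y → + 0 ℤ.< y → y ℤ.< N → InInterior e₁ q (ι² (x , y))
  window⇒InInterior x y (yA<xN , xN<yA+N) 0<y y<N = det-bounds⇒InInterior (x , y)
    (j<i⇒0<i-j yA<xN) (i<j+k⇒i-j<k xN<yA+N)
    (subst (+ 0 ℤ.<_) (sym (det-e₁ x y)) 0<y) (subst (ℤ._< N) (sym (det-e₁ x y)) y<N)

  window⇒InInteriorℕ : ∀ x y → y ℕ.* a < x ℕ.* suc m → x ℕ.* suc m < y ℕ.* a ℕ.+ suc m → 0 < y → y < suc m →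
    InInterior e₁ q (ι² (+ x , + y))
  window⇒InInteriorℕ x y ya<xN xN<ya+N 0<y y<N = window⇒InInterior (+ x) (+ y)
    (subst₂ ℤ._<_ (ℤP.pos-* y a) (ℤP.pos-* x (suc m)) (ℤ.+<+ ya<xN) ,
     subst₂ ℤ._<_ (ℤP.pos-* x (suc m)) (trans (ℤP.pos-+ (y ℕ.* a) (suc m)) (cong (ℤ._+ N) (ℤP.pos-* y a))) (ℤ.+<+ xN<ya+N))
    (ℤ.+<+ 0<y) (ℤ.+<+ y<N)

  window-unique : ∀ {x x′ y} → Window x y → Window x′ y → x ≡ x′
  window-unique (l , u) (l′ , u′) = multiple-in-window-unique m l u l′ u′

  interior-abscissa : ∀ x x′ y → InInterior e₁ q (ι² (x , y)) → Window x′ y → x ≡ x′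
  interior-abscissa x x′ y int = window-unique {x} {x′} {y} (proj₁ (InInterior⇒window x y int))

  abscissa-unique : ∀ x x′ y → InInterior e₁ q (ι² (x , y)) → InInterior e₁ q (ι² (x′ , y)) → x ≡ x′
  abscissa-unique x x′ y int int′ =
    window-unique {x} {x′} {y} (proj₁ (InInterior⇒window x y int)) (proj₁ (InInterior⇒window x′ y int′))

  [1,1]-interior : 1 ≤ a → a < suc m → InInterior e₁ q (ι² (+ 1 , + 1))
  [1,1]-interior 1≤a a<N = window⇒InInteriorℕ 1 1
    (subst₂ _<_ (sym (ℕP.*-identityˡ a)) (sym (ℕP.*-identityˡ (suc m))) a<N)
    (subst₂ _<_ (sym (ℕP.*-identityˡ (suc m))) (cong (ℕ._+ suc m) (sym (ℕP.*-identityˡ a))) (ℕP.m<n+m (suc m) 1≤a))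
    (s≤s z≤n) (s≤s (ℕP.≤-trans 1≤a (ℕP.≤-pred a<N)))

gcd[n,n]≡n : ∀ n → gcd n n ≡ n
gcd[n,n]≡n n = ℕG.GCD.unique (ℕG.gcd-GCD n n) ℕG.GCD.refl

gcd[n,1+n]≡1 : ∀ n → gcd n (suc n) ≡ 1
gcd[n,1+n]≡1 n = subst (λ k → gcd n k ≡ 1) (ℕP.+-comm n 1) (Cop.coprime⇒gcd≡1 (Cop.sym (Cop.coprime-+ (Cop.1-coprimeTo n))))

positive-ℤ : ∀ {y} → + 0 ℤ.< y → ∃[ k ] (y ≡ + suc k)
positive-ℤ {+ suc k} _ = k , refl
positive-ℤ {+ zero} (ℤ.+<+ ())

interior-of-P[n-1,n]-diagonal : ∀ m x y → InInterior e₁ (+ m , + suc m) (ι² (x , y)) → x ≡ y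
interior-of-P[n-1,n]-diagonal m x y int = interior-abscissa x y y int (diagonal-window bounds)
  where
  open Standard m m
  bounds : (+ 0 ℤ.< y) × (y ℤ.< N)
  bounds = proj₂ (InInterior⇒window x y int)
  plus-one : ∀ y M → y ℤ.* M ℤ.+ y ≡ y ℤ.* (+ 1 ℤ.+ M)
  plus-one = solveℤ
  diagonal-window : (+ 0 ℤ.< y) × (y ℤ.< N) → Window y y
  diagonal-window (0<y , y<N) =
    subst₂ ℤ._<_ (ℤP.+-identityʳ (y ℤ.* + m)) (plus-one y (+ m)) (ℤP.+-monoʳ-< (y ℤ.* + m) 0<y) ,
    subst (ℤ._< y ℤ.* + m ℤ.+ N) (plus-one y (+ m)) (ℤP.+-monoʳ-< (y ℤ.* + m) y<N)

interior-of-P[1,n]-abscissa : ∀ m x y → InInterior e₁ (+ 1 , + suc m) (ι² (x , y)) → x ≡ + 1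
interior-of-P[1,n]-abscissa m x y int = interior-abscissa x (+ 1) y int (unit-window (proj₂ (InInterior⇒window x y int)))
  where
  open Standard m 1
  unit-window : ∀ {y} → (+ 0 ℤ.< y) × (y ℤ.< N) → Window (+ 1) y
  unit-window {y} (0<y , y<N) =
    subst₂ ℤ._<_ (sym (ℤP.*-identityʳ y)) (sym (ℤP.*-identityˡ N)) y<N ,
    subst₂ ℤ._<_ (sym (ℤP.*-identityˡ N)) (cong (ℤ._+ N) (sym (ℤP.*-identityʳ y)))
      (subst (ℤ._< y ℤ.+ N) (ℤP.+-identityˡ N) (ℤP.+-monoˡ-< N 0<y))

-- Visible interior points of P_{a,n}

V[P[n-1,n]]≡1 : ∀ m → 1 ≤ m → V≡ e₁ (+ m , + suc m) 1
V[P[n-1,n]]≡1 m 1≤m = (+ 1 , + 1) ∷ [] , [] ∷ [] , (λ w → mk⇔ (to w) (from w)) , refl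
  where
  open Standard m m
  to : ∀ w → w ∈ (+ 1 , + 1) ∷ [] → VisInt e₁ q w
  to _ (here refl) = [1,1]-interior 1≤m (ℕP.n<1+n m) , refl
  [1,1]∈ : ∀ x y → x ≡ y → ∃[ k ] (y ≡ + suc k) → Visible (x , y) → (x , y) ∈ (+ 1 , + 1) ∷ []
  [1,1]∈ _ _ refl (k , refl) vis with trans (sym (gcd[n,n]≡n (suc k))) vis
  ... | refl = here refl
  from : ∀ w → VisInt e₁ q w → w ∈ (+ 1 , + 1) ∷ []
  from (x , y) (int , vis) = [1,1]∈ x y (interior-of-P[n-1,n]-diagonal m x y int)
    (positive-ℤ (proj₁ (proj₂ (InInterior⇒window x y int)))) vis

V[P[1,n]]≡n-1 : ∀ m → V≡ e₁ (+ 1 , + suc m) m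
V[P[1,n]]≡n-1 m = map point (upTo m) , UniqueP.map⁺ point-injective (UniqueP.upTo⁺ m) ,
  (λ w → mk⇔ (to w) (from w)) , trans (ListP.length-map point (upTo m)) (ListP.length-upTo m)
  where
  open Standard m 1
  point : ℕ → ℤ²
  point k = (+ 1 , + suc k)
  point-injective : ∀ {k k′} → point k ≡ point k′ → k ≡ k′
  point-injective refl = refl
  to : ∀ w → w ∈ map point (upTo m) → VisInt e₁ q w
  to w w∈ with ∈P.∈-map⁻ point w∈
  ... | k , k∈ , refl = window⇒InInteriorℕ 1 (suc k)
    (subst₂ _<_ (sym (ℕP.*-identityʳ (suc k))) (sym (ℕP.*-identityˡ (suc m))) (s≤s (∈P.∈-upTo⁻ k∈)))
    (subst₂ _<_ (sym (ℕP.*-identityˡ (suc m))) (cong (ℕ._+ suc m) (sym (ℕP.*-identityʳ (suc k)))) (ℕP.m<n+m (suc m) (s≤s z≤n)))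
    (s≤s z≤n) (s≤s (∈P.∈-upTo⁻ k∈)) , ℕG.gcd-zeroˡ (suc k)
  listed : ∀ x y → x ≡ + 1 → ∃[ k ] (y ≡ + suc k) → y ℤ.< N → (x , y) ∈ map point (upTo m)
  listed _ _ refl (k , refl) y<N = ∈P.∈-map⁺ point (∈P.∈-upTo⁺ (ℕP.≤-pred (ℤP.drop‿+<+ y<N)))
  from : ∀ w → VisInt e₁ q w → w ∈ map point (upTo m)
  from (x , y) (int , _) = listed x y (interior-of-P[1,n]-abscissa m x y int)
    (positive-ℤ (proj₁ (proj₂ (InInterior⇒window x y int)))) (proj₂ (proj₂ (InInterior⇒window x y int)))

length≡1⇒∈-unique : ∀ {A : Set} {xs : List A} {x y} → length xs ≡ 1 → x ∈ xs → y ∈ xs → x ≡ y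
length≡1⇒∈-unique {xs = _ ∷ []} _ (here refl) (here refl) = refl

-- (Q , Q + 1) is a visible interior point of P_{a,n}.
consecutive-point-window : ∀ n a b Q R → 1 ≤ a → 2 ≤ b → R < b → n ≡ a ℕ.+ b → n ≡ R ℕ.+ Q ℕ.* b →
  (suc Q ℕ.* a < Q ℕ.* n) × (Q ℕ.* n < suc Q ℕ.* a ℕ.+ n) × (suc Q < n) × (1 ≤ Q)
consecutive-point-window n a b Q R 1≤a 2≤b R<b n≡a+b n≡R+Qb = yQa<Qn , Qn<yQa+n , suc-Q<n , 1≤Q
  where
  open ℕP.≤-Reasoning
  a<Qb : a < Q ℕ.* b
  a<Qb = ℕP.+-cancelʳ-< b a (Q ℕ.* b) (begin-strict
    a ℕ.+ b        ≡⟨ trans (sym n≡a+b) n≡R+Qb ⟩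
    R ℕ.+ Q ℕ.* b  <⟨ ℕP.+-monoˡ-< (Q ℕ.* b) R<b ⟩
    b ℕ.+ Q ℕ.* b  ≡⟨ ℕP.+-comm b (Q ℕ.* b) ⟩
    Q ℕ.* b ℕ.+ b  ∎)
  Qn≡Qa+Qb : Q ℕ.* n ≡ Q ℕ.* a ℕ.+ Q ℕ.* b
  Qn≡Qa+Qb = trans (cong (Q ℕ.*_) n≡a+b) (ℕP.*-distribˡ-+ Q a b)
  Qb≤n : Q ℕ.* b ≤ n
  Qb≤n = subst (Q ℕ.* b ≤_) (sym n≡R+Qb) (ℕP.m≤n+m (Q ℕ.* b) R)
  yQa<Qn : suc Q ℕ.* a < Q ℕ.* n
  yQa<Qn = begin-strict
    a ℕ.+ Q ℕ.* a      <⟨ ℕP.+-monoˡ-< (Q ℕ.* a) a<Qb ⟩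
    Q ℕ.* b ℕ.+ Q ℕ.* a ≡⟨ ℕP.+-comm (Q ℕ.* b) (Q ℕ.* a) ⟩
    Q ℕ.* a ℕ.+ Q ℕ.* b ≡⟨ sym Qn≡Qa+Qb ⟩
    Q ℕ.* n            ∎
  Qn<yQa+n : Q ℕ.* n < suc Q ℕ.* a ℕ.+ n
  Qn<yQa+n = begin-strict
    Q ℕ.* n                ≡⟨ Qn≡Qa+Qb ⟩
    Q ℕ.* a ℕ.+ Q ℕ.* b     ≤⟨ ℕP.+-monoʳ-≤ (Q ℕ.* a) Qb≤n ⟩
    Q ℕ.* a ℕ.+ n           <⟨ ℕP.+-monoˡ-< n (ℕP.m<n+m (Q ℕ.* a) 1≤a) ⟩
    (a ℕ.+ Q ℕ.* a) ℕ.+ n   ∎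
  2<n : 2 < n
  2<n = subst (2 <_) (sym n≡a+b) (ℕP.+-mono-≤ 1≤a 2≤b)
  suc-Q<n : suc Q < n
  suc-Q<n = ℕP.*-cancelʳ-< 2 (suc Q) n (begin-strict
    2 ℕ.+ Q ℕ.* 2  ≤⟨ ℕP.+-monoʳ-≤ 2 (ℕP.≤-trans (ℕP.*-monoʳ-≤ Q 2≤b) Qb≤n) ⟩
    2 ℕ.+ n        <⟨ ℕP.+-monoˡ-< n 2<n ⟩
    n ℕ.+ n        ≡⟨ double n ⟩
    n ℕ.* 2        ∎)
    where
    double : ∀ n → n ℕ.+ n ≡ n ℕ.* 2
    double = solveℕ
  1≤Q : 1 ≤ Q
  1≤Q = ℕP.≮⇒≥ λ Q<1 → ℕP.<-irrefl refl (begin-strict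
    n              ≡⟨ trans n≡R+Qb (cong (λ k → R ℕ.+ k ℕ.* b) (ℕP.n<1⇒n≡0 Q<1)) ⟩
    R ℕ.+ 0        ≡⟨ ℕP.+-identityʳ R ⟩
    R              <⟨ R<b ⟩
    b              ≤⟨ ℕP.m≤n+m b a ⟩
    a ℕ.+ b        ≡⟨ sym n≡a+b ⟩
    n              ∎)

a<n-1⇒V≢1 : ∀ m a → 1 ≤ a → a < m → ¬ V≡ e₁ (+ a , + suc m) 1
a<n-1⇒V≢1 m a 1≤a a<m (xs , _ , mem , len) =
  1≤Q⇒Q≢0 (proj₂ (proj₂ (proj₂ window))) (ℕP.suc-injective (cong (λ w → ∣ proj₂ w ∣) same))
  where
  open Standard m a
  a+2≤n : suc (suc a) ≤ suc m
  a+2≤n = s≤s a<m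
  b : ℕ
  b = suc (suc (proj₁ (ℕP.m≤n⇒∃[o]m+o≡n a+2≤n)))
  n≡a+b : suc m ≡ a ℕ.+ b
  n≡a+b = trans (sym (proj₂ (ℕP.m≤n⇒∃[o]m+o≡n a+2≤n))) (shift a (proj₁ (ℕP.m≤n⇒∃[o]m+o≡n a+2≤n)))
    where
    shift : ∀ a o → suc (suc a) ℕ.+ o ≡ a ℕ.+ suc (suc o)
    shift = solveℕ
  Q : ℕ
  Q = suc m ℕDM./ b
  window : (suc Q ℕ.* a < Q ℕ.* suc m) × (Q ℕ.* suc m < suc Q ℕ.* a ℕ.+ suc m) × (suc Q < suc m) × (1 ≤ Q)
  window = consecutive-point-window (suc m) a b Q (suc m ℕDM.% b) 1≤a (s≤s (s≤s z≤n))
    (ℕDM.m%n<n (suc m) b) n≡a+b (ℕDM.m≡m%n+[m/n]*n (suc m) b)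
  1≤Q⇒Q≢0 : 1 ≤ Q → Q ≢ 0
  1≤Q⇒Q≢0 1≤Q Q≡0 = ℕP.<-irrefl (sym Q≡0) 1≤Q
  same : (+ Q , + suc Q) ≡ (+ 1 , + 1)
  same = length≡1⇒∈-unique len
    (Equivalence.from (mem _) (window⇒InInteriorℕ Q (suc Q) (proj₁ window) (proj₁ (proj₂ window))
      (s≤s z≤n) (proj₁ (proj₂ (proj₂ window))) , gcd[n,1+n]≡1 Q))
    (Equivalence.from (mem _) ([1,1]-interior 1≤a (ℕP.m<n⇒m<1+n a<m) , refl))

V≡1⇒a≡n-1 : ∀ m a → 1 ≤ a → a < suc m → V≡ e₁ (+ a , + suc m) 1 → a ≡ m
V≡1⇒a≡n-1 m a 1≤a a<n V≡1 =
  decidable-stable (a ℕ.≟ m) λ a≢m → a<n-1⇒V≢1 m a 1≤a (ℕP.≤∧≢⇒< (ℕP.≤-pred a<n) a≢m) V≡1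

Unique-map-injectiveOn : ∀ {A : Set} (f : A → ℕ) (xs : List A) →
  (∀ {x y} → x ∈ xs → y ∈ xs → f x ≡ f y → x ≡ y) → Unique xs → Unique (map f xs)
Unique-map-injectiveOn f [] _ [] = []
Unique-map-injectiveOn f (x ∷ xs) injective (x∉xs ∷ unique) =
  distinct xs x∉xs (λ y∈ → injective (here refl) (there y∈)) ∷
  Unique-map-injectiveOn f xs (λ x∈ y∈ → injective (there x∈) (there y∈)) unique
  where
  distinct : ∀ zs → All (x ≢_) zs → (∀ {y} → y ∈ zs → f x ≡ f y → x ≡ y) → All (f x ≢_) (map f zs)
  distinct [] [] _ = []
  distinct (z ∷ zs) (x≢z ∷ x∉zs) inj = (λ e → x≢z (inj (here refl) e)) ∷ distinct zs x∉zs (λ y∈ → inj (there y∈))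

All-map : ∀ {A : Set} {P : ℕ → Set} (f : A → ℕ) (xs : List A) → (∀ {x} → x ∈ xs → P (f x)) → All P (map f xs)
All-map f [] _ = []
All-map f (x ∷ xs) h = h (here refl) ∷ All-map f xs (λ x∈ → h (there x∈))

private
  drop-maximum : ∀ L (ys : List ℕ) → Unique ys → All (_< suc L) ys → length ys ≤ suc (length (filter (ℕ._<? L) ys))
  drop-maximum L [] _ _ = z≤n
  drop-maximum L (y ∷ ys) (y∉ys ∷ unique) (y≤L ∷ ys≤L) with y ℕ.<? L
  ... | yes y<L rewrite ListP.filter-accept (ℕ._<? L) {y} {ys} y<L = s≤s (drop-maximum L ys unique ys≤L)
  ... | no y≮L rewrite ListP.filter-reject (ℕ._<? L) {y} {ys} y≮L =
    s≤s (ℕP.≤-reflexive (sym (cong length (ListP.filter-all (ℕ._<? L) (below ys y∉ys ys≤L)))))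
    where
    y≡L : y ≡ L
    y≡L = ℕP.≤-antisym (ℕP.≤-pred y≤L) (ℕP.≮⇒≥ y≮L)
    below : ∀ zs → All (y ≢_) zs → All (_< suc L) zs → All (_< L) zs
    below [] [] [] = []
    below (z ∷ zs) (y≢z ∷ y∉zs) (z≤L ∷ zs≤L) =
      ℕP.≤∧≢⇒< (ℕP.≤-pred z≤L) (λ z≡L → y≢z (trans y≡L (sym z≡L))) ∷ below zs y∉zs zs≤L

Unique-All<⇒length≤ : ∀ L (ys : List ℕ) → Unique ys → All (_< L) ys → length ys ≤ L
Unique-All<⇒length≤ zero [] _ _ = z≤n
Unique-All<⇒length≤ zero (_ ∷ _) _ (() ∷ _)
Unique-All<⇒length≤ (suc L) ys unique ys<L = ℕP.≤-trans (drop-maximum L ys unique ys<L)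
  (s≤s (Unique-All<⇒length≤ L (filter (ℕ._<? L) ys) (UniqueP.filter⁺ (ℕ._<? L) unique) (AllP.all-filter (ℕ._<? L) ys)))

Unique-avoiding⇒length≤ : ∀ L K (ys : List ℕ) → Unique ys → K < suc L →
  All (λ y → y < suc L × y ≢ K) ys → length ys ≤ L
Unique-avoiding⇒length≤ L K ys unique K≤L ys-ok = subst (_≤ L) (ListP.length-map relabel ys)
  (Unique-All<⇒length≤ L (map relabel ys) (Unique-map-injectiveOn relabel ys injective unique)
    (All-map relabel ys λ y∈ → relabel< (lookup ys-ok y∈)))
  where
  relabel : ℕ → ℕ
  relabel y with y ℕ.≟ L
  ... | yes _ = K
  ... | no _  = y
  relabel< : ∀ {y} → y < suc L × y ≢ K → relabel y < L
  relabel< {y} (y≤L , y≢K) with y ℕ.≟ L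
  ... | yes y≡L = ℕP.≤∧≢⇒< (ℕP.≤-pred K≤L) (λ K≡L → y≢K (trans y≡L (sym K≡L)))
  ... | no y≢L  = ℕP.≤∧≢⇒< (ℕP.≤-pred y≤L) y≢L
  injective : ∀ {y y′} → y ∈ ys → y′ ∈ ys → relabel y ≡ relabel y′ → y ≡ y′
  injective {y} {y′} y∈ y′∈ e with y ℕ.≟ L | y′ ℕ.≟ L
  ... | yes y≡L | yes y′≡L = trans y≡L (sym y′≡L)
  ... | yes _   | no _     = ⊥-elim (proj₂ (lookup ys-ok y′∈) (sym e))
  ... | no _    | yes _    = ⊥-elim (proj₂ (lookup ys-ok y∈) e)
  ... | no _    | no _     = e

-- (2 , 2(Q + 1)) is an invisible interior point of P_{a,n}.
even-point-window : ∀ n a Q R → 2 ≤ a → a < n → R < 2 ℕ.* a → n ≡ R ℕ.+ Q ℕ.* (2 ℕ.* a) → ¬ (Q ≡ 1 × R ≡ 0) →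
  (2 ℕ.* suc Q ℕ.* a < 2 ℕ.* n) × (2 ℕ.* n < 2 ℕ.* suc Q ℕ.* a ℕ.+ n) × (2 ℕ.* suc Q < n)
even-point-window n a Q R 2≤a a<n R<2a n≡R+2aQ n≢2a = Ka<2n , 2n<Ka+n , K<n
  where
  open ℕP.≤-Reasoning
  X : ℕ
  X = Q ℕ.* a
  n≡R+2X : n ≡ R ℕ.+ (X ℕ.+ X)
  n≡R+2X = trans n≡R+2aQ (cong (R ℕ.+_) (double Q a))
    where
    double : ∀ Q a → Q ℕ.* (2 ℕ.* a) ≡ Q ℕ.* a ℕ.+ Q ℕ.* a
    double = solveℕ
  Ka≡ : 2 ℕ.* suc Q ℕ.* a ≡ (a ℕ.+ X) ℕ.+ (a ℕ.+ X)
  Ka≡ = expand Q a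
    where
    expand : ∀ Q a → 2 ℕ.* suc Q ℕ.* a ≡ (a ℕ.+ Q ℕ.* a) ℕ.+ (a ℕ.+ Q ℕ.* a)
    expand = solveℕ
  a<X+R : a < X ℕ.+ R
  a<X+R = by-cases Q R n≡R+2aQ n≢2a
    where
    by-cases : ∀ Q R → n ≡ R ℕ.+ Q ℕ.* (2 ℕ.* a) → ¬ (Q ≡ 1 × R ≡ 0) → a < Q ℕ.* a ℕ.+ R
    by-cases zero R e _ = subst (a <_) (trans e (ℕP.+-identityʳ R)) a<n
    by-cases (suc zero) zero _ n≢2a = ⊥-elim (n≢2a (refl , refl))
    by-cases (suc zero) (suc R) _ _ = subst (a <_) (cong (ℕ._+ suc R) (sym (ℕP.+-identityʳ a))) (ℕP.m<m+n a (s≤s z≤n))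
    by-cases (suc (suc Q)) R _ _ = ℕP.<-≤-trans (ℕP.m<m+n a (ℕP.≤-trans (s≤s z≤n) 2≤a))
      (ℕP.≤-trans (ℕP.+-monoʳ-≤ a (ℕP.m≤m+n a (Q ℕ.* a))) (ℕP.m≤m+n (a ℕ.+ (a ℕ.+ Q ℕ.* a)) R))
  n<Ka : n < 2 ℕ.* suc Q ℕ.* a
  n<Ka = begin-strict
    n                         ≡⟨ n≡R+2X ⟩
    R ℕ.+ (X ℕ.+ X)           <⟨ ℕP.+-monoˡ-< (X ℕ.+ X) R<2a ⟩
    2 ℕ.* a ℕ.+ (X ℕ.+ X)     ≡⟨ regroup a X ⟩
    (a ℕ.+ X) ℕ.+ (a ℕ.+ X)   ≡⟨ sym Ka≡ ⟩
    2 ℕ.* suc Q ℕ.* a         ∎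
    where
    regroup : ∀ a X → 2 ℕ.* a ℕ.+ (X ℕ.+ X) ≡ (a ℕ.+ X) ℕ.+ (a ℕ.+ X)
    regroup = solveℕ
  Ka<2n : 2 ℕ.* suc Q ℕ.* a < 2 ℕ.* n
  Ka<2n = begin-strict
    2 ℕ.* suc Q ℕ.* a                       ≡⟨ Ka≡ ⟩
    (a ℕ.+ X) ℕ.+ (a ℕ.+ X)                 <⟨ ℕP.+-mono-< a+X<R+2X a+X<R+2X ⟩
    (X ℕ.+ R ℕ.+ X) ℕ.+ (X ℕ.+ R ℕ.+ X)     ≡⟨ regroup X R ⟩
    2 ℕ.* (R ℕ.+ (X ℕ.+ X))                 ≡⟨ cong (2 ℕ.*_) (sym n≡R+2X) ⟩
    2 ℕ.* n                                 ∎
    where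
    a+X<R+2X : a ℕ.+ X < X ℕ.+ R ℕ.+ X
    a+X<R+2X = ℕP.+-monoˡ-< X a<X+R
    regroup : ∀ X R → (X ℕ.+ R ℕ.+ X) ℕ.+ (X ℕ.+ R ℕ.+ X) ≡ 2 ℕ.* (R ℕ.+ (X ℕ.+ X))
    regroup = solveℕ
  2n<Ka+n : 2 ℕ.* n < 2 ℕ.* suc Q ℕ.* a ℕ.+ n
  2n<Ka+n = subst (_< 2 ℕ.* suc Q ℕ.* a ℕ.+ n) (double n) (ℕP.+-monoˡ-< n n<Ka)
    where
    double : ∀ n → n ℕ.+ n ≡ 2 ℕ.* n
    double = solveℕ
  K<n : 2 ℕ.* suc Q < n
  K<n = ℕP.*-cancelʳ-< 2 (2 ℕ.* suc Q) n (begin-strict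
    2 ℕ.* suc Q ℕ.* 2   ≤⟨ ℕP.*-monoʳ-≤ (2 ℕ.* suc Q) 2≤a ⟩
    2 ℕ.* suc Q ℕ.* a   <⟨ Ka<2n ⟩
    2 ℕ.* n             ≡⟨ ℕP.*-comm 2 n ⟩
    n ℕ.* 2             ∎)


2≤a⇒V≢n-1 : ∀ L a → 2 ≤ a → a < suc (suc L) → gcd a (suc (suc L)) ≡ 1 → ¬ V≡ e₁ (+ a , + suc (suc L)) (suc L)
2≤a⇒V≢n-1 L a 2≤a a<n coprime (xs , unique , mem , len) = ℕP.<-irrefl refl (ℕP.<-≤-trans (ℕP.n<1+n L) (begin
    suc L                  ≡⟨ sym len ⟩
    length xs              ≡⟨ sym (ListP.length-map ordinate xs) ⟩
    length (map ordinate xs) ≤⟨ Unique-avoiding⇒length≤ L (ℕ.pred K) (map ordinate xs)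
                                 (Unique-map-injectiveOn ordinate xs ordinate-injective unique) K-1<n-1
                                 (All-map ordinate xs ordinate-bounds) ⟩
    L                      ∎))
  where
  open ℕP.≤-Reasoning
  n : ℕ
  n = suc (suc L)
  open Standard (suc L) a
  instance
    2a≢0 : ℕ.NonZero (2 ℕ.* a)
    2a≢0 = ℕ.>-nonZero (ℕP.<-≤-trans (s≤s z≤n) (ℕP.*-monoʳ-≤ 2 2≤a))
  Q R : ℕ
  Q = n ℕDM./ (2 ℕ.* a)
  R = n ℕDM.% (2 ℕ.* a)
  n≡R+2aQ : n ≡ R ℕ.+ Q ℕ.* (2 ℕ.* a)
  n≡R+2aQ = ℕDM.m≡m%n+[m/n]*n n (2 ℕ.* a)
  n≢2a : ¬ (Q ≡ 1 × R ≡ 0)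
  n≢2a (Q≡1 , R≡0) =
    ℕP.<-irrefl (sym (ℕD.∣1⇒≡1 (subst (a ℕD.∣_) coprime (ℕG.gcd-greatest ℕD.∣-refl (ℕD.divides 2 n≡2a))))) 2≤a
    where
    n≡2a : n ≡ 2 ℕ.* a
    n≡2a = trans n≡R+2aQ (trans (cong₂ (λ r k → r ℕ.+ k ℕ.* (2 ℕ.* a)) R≡0 Q≡1) (ℕP.+-identityʳ (2 ℕ.* a)))
  K : ℕ
  K = 2 ℕ.* suc Q
  window : (K ℕ.* a < 2 ℕ.* n) × (2 ℕ.* n < K ℕ.* a ℕ.+ n) × (K < n)
  window = even-point-window n a Q R 2≤a a<n (ℕDM.m%n<n n (2 ℕ.* a)) n≡R+2aQ n≢2a
  K-1<n-1 : ℕ.pred K < suc L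
  K-1<n-1 = ℕP.≤-pred (proj₂ (proj₂ window))
  [2,K]-interior : InInterior e₁ q (ι² (+ 2 , + K))
  [2,K]-interior = window⇒InInteriorℕ 2 K (proj₁ window) (proj₁ (proj₂ window)) (s≤s z≤n) (proj₂ (proj₂ window))
  [2,K]-invisible : ¬ Visible (+ 2 , + K)
  [2,K]-invisible vis = 2≢1 (ℕD.∣1⇒≡1 (subst (2 ℕD.∣_) vis (ℕG.gcd-greatest ℕD.∣-refl (ℕD.m∣m*n (suc Q)))))
    where
    2≢1 : 2 ≢ 1
    2≢1 ()
  ordinate : ℤ² → ℕ
  ordinate (_ , y) = ℕ.pred ∣ y ∣
  interior : ∀ {w} → w ∈ xs → InInterior e₁ q (ι² w)
  interior w∈ = proj₁ (Equivalence.to (mem _) w∈)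
  ordinate-range : ∀ y → + 0 ℤ.< y → y ℤ.< N → y ≡ + suc (ℕ.pred ∣ y ∣) × ℕ.pred ∣ y ∣ < suc L
  ordinate-range (+ suc k) _ (ℤ.+<+ k<N) = refl , ℕP.≤-pred k<N
  ordinate-range (+ zero) (ℤ.+<+ ()) _
  ordinate-from : ∀ {w} → w ∈ xs → proj₂ w ≡ + suc (ordinate w) × ordinate w < suc L
  ordinate-from {x , y} w∈ = ordinate-range y (proj₁ bounds) (proj₂ bounds)
    where
    bounds : (+ 0 ℤ.< y) × (y ℤ.< N)
    bounds = proj₂ (InInterior⇒window x y (interior w∈))
  ordinate-bounds : ∀ {w} → w ∈ xs → ordinate w < suc L × ordinate w ≢ ℕ.pred K
  ordinate-bounds {x , y} w∈ = proj₂ (ordinate-from w∈) , λ e → [2,K]-invisible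
    (subst (λ z → Visible (z , + K)) (abscissa-unique x (+ 2) (+ K) (int-K e) [2,K]-interior) (vis-K e))
    where
    y≡K : ordinate (x , y) ≡ ℕ.pred K → y ≡ + K
    y≡K e = trans (proj₁ (ordinate-from w∈)) (cong (λ k → + suc k) e)
    int-K : ordinate (x , y) ≡ ℕ.pred K → InInterior e₁ q (ι² (x , + K))
    int-K e = subst (λ z → InInterior e₁ q (ι² (x , z))) (y≡K e) (interior w∈)
    vis-K : ordinate (x , y) ≡ ℕ.pred K → Visible (x , + K)
    vis-K e = subst (λ z → Visible (x , z)) (y≡K e) (proj₂ (Equivalence.to (mem _) w∈))
  ordinate-injective : ∀ {w w′} → w ∈ xs → w′ ∈ xs → ordinate w ≡ ordinate w′ → w ≡ w′
  ordinate-injective {x , y} {x′ , y′} w∈ w′∈ e = cong₂ _,_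
    (abscissa-unique x x′ y (interior w∈) (subst (λ z → InInterior e₁ q (ι² (x′ , z))) (sym y≡y′) (interior w′∈)))
    y≡y′
    where
    y≡y′ : y ≡ y′
    y≡y′ = trans (proj₁ (ordinate-from w∈)) (trans (cong (λ k → + suc k) e) (sym (proj₁ (ordinate-from w′∈))))


V≡n-1⇒a≡1 : ∀ m a → 1 ≤ a → a < suc m → gcd a (suc m) ≡ 1 → V≡ e₁ (+ a , + suc m) m → a ≡ 1
V≡n-1⇒a≡1 zero a 1≤a a<1 _ _ = ⊥-elim (ℕP.<-irrefl refl (ℕP.<-≤-trans a<1 1≤a))
V≡n-1⇒a≡1 (suc L) a 1≤a a<n coprime V≡n-1 =
  decidable-stable (a ℕ.≟ 1) λ a≢1 → 2≤a⇒V≢n-1 L a (ℕP.≤∧≢⇒< 1≤a (λ 1≡a → a≢1 (sym 1≡a))) a<n coprime V≡n-1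

V[P[a,n]]≡1⇔a≡n-1 : ∀ m a → 1 ≤ m → 1 ≤ a → a < suc m → V≡ e₁ (+ a , + suc m) 1 ⇔ a ≡ m
V[P[a,n]]≡1⇔a≡n-1 m a 1≤m 1≤a a<n = mk⇔ (V≡1⇒a≡n-1 m a 1≤a a<n) λ { refl → V[P[n-1,n]]≡1 m 1≤m }

V[P[a,n]]≡n-1⇔a≡1 : ∀ m a → 1 ≤ a → a < suc m → gcd a (suc m) ≡ 1 → V≡ e₁ (+ a , + suc m) m ⇔ a ≡ 1
V[P[a,n]]≡n-1⇔a≡1 m a 1≤a a<n coprime = mk⇔ (V≡n-1⇒a≡1 m a 1≤a a<n coprime) λ { refl → V[P[1,n]]≡n-1 m }

-- Diagonals of P_{a,n}

AllInterior : (ℤ² → ℤ² → ℤ² → Set) → ℤ² → ℤ² → Set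
AllInterior F u v = ∀ w → InInterior u v (ι² w) → F u v w

on-main-diagonal⇒a≡n-1 : ∀ m a → 1 ≤ a → a < suc m →
  AllInterior OnMainDiag e₁ (+ a , + suc m) → a ≡ m
on-main-diagonal⇒a≡n-1 m a 1≤a a<n all-on-diagonal = ℕP.suc-injective (ℤP.+-injective (ι-injective (begin
  A                                ≡⟨ sym (ℚP.*-identityʳ A) ⟩
  A ℚ.* 1ℚ                         ≡⟨ cong (A ℚ.*_) (cong proj₂ e) ⟩
  A ℚ.* (t ℚ.* B ℚ.+ 0ℚ ℚ.* 0ℚ)    ≡⟨ exchange t A B ⟩
  B ℚ.* (t ℚ.* A ℚ.+ 0ℚ ℚ.* 0ℚ)    ≡⟨ cong (B ℚ.*_) (sym (cong proj₁ e)) ⟩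
  B ℚ.* 1ℚ                         ≡⟨ ℚP.*-identityʳ B ⟩
  B                                ∎)))
  where
  open ≡-Reasoning
  A B : ℚ
  A = ι (+ suc a)
  B = ι (+ suc m)
  [1,1]-on-diagonal : OnMainDiag e₁ (+ a , + suc m) (+ 1 , + 1)
  [1,1]-on-diagonal = all-on-diagonal (+ 1 , + 1) (Standard.[1,1]-interior m a 1≤a a<n)
  t : ℚ
  t = proj₁ [1,1]-on-diagonal
  e : (1ℚ , 1ℚ) ≡ (t ℚ.* A ℚ.+ 0ℚ ℚ.* 0ℚ , t ℚ.* B ℚ.+ 0ℚ ℚ.* 0ℚ)
  e = proj₂ (proj₂ [1,1]-on-diagonal)
  exchange : ∀ t A B → A ℚ.* (t ℚ.* B ℚ.+ 0ℚ ℚ.* 0ℚ) ≡ B ℚ.* (t ℚ.* A ℚ.+ 0ℚ ℚ.* 0ℚ)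
  exchange = solve-∀ ℚ-ring

interior-of-P[n-1,n]-on-main-diagonal : ∀ m x y → InInterior e₁ (+ m , + suc m) (ι² (x , y)) →
  OnMainDiag e₁ (+ m , + suc m) (x , y)
interior-of-P[n-1,n]-on-main-diagonal m x y int =
  frac y , (frac-nonNeg (ℤP.<⇒≤ 0<y) , frac≤1 (ℤP.<⇒≤ y<N)) ,
  cong₂ _,_ (trans (cong ι (interior-of-P[n-1,n]-diagonal m x y int)) coordinate) coordinate
  where
  open Fraction m
  open Standard m m using (InInterior⇒window)
  0<y : + 0 ℤ.< y
  0<y = proj₁ (proj₂ (InInterior⇒window x y int))
  y<N : y ℤ.< + suc m
  y<N = proj₂ (proj₂ (InInterior⇒window x y int))
  coordinate : ι y ≡ frac y ℚ.* ι (+ suc m) ℚ.+ 0ℚ ℚ.* 0ℚ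
  coordinate = sym (trans (ℚP.+-identityʳ (frac y ℚ.* ι (+ suc m))) (frac-*-denominator y))

on-anti-diagonal⇒a≡1 : ∀ m a → 1 ≤ a → a < suc m →
  AllInterior OnAntiDiag e₁ (+ a , + suc m) → a ≡ 1
on-anti-diagonal⇒a≡1 m a 1≤a a<n all-on-diagonal = ℤP.+-injective (ι-injective (begin
  A                                     ≡⟨ sym (minus-plus A 1ℚ) ⟩
  (A ℚ.- 1ℚ) ℚ.+ 1ℚ                     ≡⟨ cong (ℚ._+ 1ℚ) (eliminate t A B) ⟩
  combination x y ℚ.+ 1ℚ                ≡⟨ cong₂ (λ x′ y′ → combination x′ y′ ℚ.+ 1ℚ) (sym (cong proj₁ e)) (sym (cong proj₂ e)) ⟩
  combination 1ℚ 1ℚ ℚ.+ 1ℚ              ≡⟨ vanish A B ⟩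
  1ℚ                                    ∎))
  where
  open ≡-Reasoning
  A B : ℚ
  A = ι (+ a)
  B = ι (+ suc m)
  [1,1]-on-diagonal : OnAntiDiag e₁ (+ a , + suc m) (+ 1 , + 1)
  [1,1]-on-diagonal = all-on-diagonal (+ 1 , + 1) (Standard.[1,1]-interior m a 1≤a a<n)
  t x y : ℚ
  t = proj₁ [1,1]-on-diagonal
  x = t ℚ.* 1ℚ ℚ.+ (1ℚ ℚ.- t) ℚ.* A
  y = t ℚ.* 0ℚ ℚ.+ (1ℚ ℚ.- t) ℚ.* B
  e : (1ℚ , 1ℚ) ≡ (x , y)
  e = proj₂ (proj₂ [1,1]-on-diagonal)
  combination : ℚ → ℚ → ℚ
  combination x′ y′ = B ℚ.* x′ ℚ.- B ℚ.+ (A ℚ.- 1ℚ) ℚ.* (1ℚ ℚ.- y′)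
  minus-plus : ∀ A B → (A ℚ.- B) ℚ.+ B ≡ A
  minus-plus = solve-∀ ℚ-ring
  eliminate : ∀ t A B → A ℚ.- 1ℚ
    ≡ B ℚ.* (t ℚ.* 1ℚ ℚ.+ (1ℚ ℚ.- t) ℚ.* A) ℚ.- B ℚ.+ (A ℚ.- 1ℚ) ℚ.* (1ℚ ℚ.- (t ℚ.* 0ℚ ℚ.+ (1ℚ ℚ.- t) ℚ.* B))
  eliminate = solve-∀ ℚ-ring
  vanish : ∀ A B → (B ℚ.* 1ℚ ℚ.- B ℚ.+ (A ℚ.- 1ℚ) ℚ.* (1ℚ ℚ.- 1ℚ)) ℚ.+ 1ℚ ≡ 1ℚ
  vanish = solve-∀ ℚ-ring

interior-of-P[1,n]-on-anti-diagonal : ∀ m x y → InInterior e₁ (+ 1 , + suc m) (ι² (x , y)) →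
  OnAntiDiag e₁ (+ 1 , + suc m) (x , y)
interior-of-P[1,n]-on-anti-diagonal m x y int =
  t , (frac-nonNeg (ℤP.<⇒≤ (j<i⇒0<i-j y<N)) , frac≤1 (ℤP.<⇒≤ (i<j+k⇒i-j<k {j = y} N<y+N))) ,
  cong₂ _,_ (trans (cong ι (interior-of-P[1,n]-abscissa m x y int)) (first t)) second
  where
  open Fraction m
  open Standard m 1 using (InInterior⇒window; N)
  0<y : + 0 ℤ.< y
  0<y = proj₁ (proj₂ (InInterior⇒window x y int))
  y<N : y ℤ.< N
  y<N = proj₂ (proj₂ (InInterior⇒window x y int))
  N<y+N : N ℤ.< y ℤ.+ N
  N<y+N = subst (ℤ._< y ℤ.+ N) (ℤP.+-identityˡ N) (ℤP.+-monoˡ-< N 0<y)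
  t : ℚ
  t = frac (N ℤ.- y)
  first : ∀ t → 1ℚ ≡ t ℚ.* 1ℚ ℚ.+ (1ℚ ℚ.- t) ℚ.* 1ℚ
  first = solve-∀ ℚ-ring
  second : ι y ≡ t ℚ.* 0ℚ ℚ.+ (1ℚ ℚ.- t) ℚ.* ι N
  second = begin
    ι y                                        ≡⟨ sym (complement (ι y) (ι N)) ⟩
    ι N ℚ.- (ι N ℚ.- ι y)                      ≡⟨ cong (λ z → ι N ℚ.- z) (sym (ι-sub N y)) ⟩
    ι N ℚ.- ι (N ℤ.- y)                        ≡⟨ cong (λ z → ι N ℚ.- z) (sym (frac-*-denominator (N ℤ.- y))) ⟩
    ι N ℚ.- t ℚ.* ι N                          ≡⟨ factor t (ι N) ⟩
    t ℚ.* 0ℚ ℚ.+ (1ℚ ℚ.- t) ℚ.* ι N            ∎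
    where
    open ≡-Reasoning
    complement : ∀ Y R → R ℚ.- (R ℚ.- Y) ≡ Y
    complement = solve-∀ ℚ-ring
    factor : ∀ t R → R ℚ.- t ℚ.* R ≡ t ℚ.* 0ℚ ℚ.+ (1ℚ ℚ.- t) ℚ.* R
    factor = solve-∀ ℚ-ring

on-main-diagonal⇔a≡n-1 : ∀ m a → 1 ≤ a → a < suc m → AllInterior OnMainDiag e₁ (+ a , + suc m) ⇔ a ≡ m
on-main-diagonal⇔a≡n-1 m a 1≤a a<n = mk⇔ (on-main-diagonal⇒a≡n-1 m a 1≤a a<n)
  λ { refl (x , y) int → interior-of-P[n-1,n]-on-main-diagonal m x y int }

on-anti-diagonal⇔a≡1 : ∀ m a → 1 ≤ a → a < suc m → AllInterior OnAntiDiag e₁ (+ a , + suc m) ⇔ a ≡ 1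
on-anti-diagonal⇔a≡1 m a 1≤a a<n = mk⇔ (on-anti-diagonal⇒a≡1 m a 1≤a a<n)
  λ { refl (x , y) int → interior-of-P[1,n]-on-anti-diagonal m x y int }

-- Back from P_{a,n} to P

V≡-cong-act : ∀ T → Unimodular T → ∀ {u v p q k} → act T u ≡ p → act T v ≡ q → V≡ u v k ⇔ V≡ p q k
V≡-cong-act T U {u} {v} {k = k} refl refl = V≡-act T U u v

V≡-transfer : ∀ T u v a m {k} → Unimodular T → MapsOnto T u v e₁ (+ a , + suc m) → area u v ≡ suc m →
  V≡ u v k ⇔ V≡ e₁ (+ a , + suc m) k
V≡-transfer T u v a m {k} U onto area≡ = by-edges (MapsOnto⇒edges T u v a m U onto area≡)
  where
  q : ℤ²
  q = (+ a , + suc m)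
  by-edges : (act T u ≡ e₁ × act T v ≡ q) ⊎ (act T u ≡ q × act T v ≡ e₁) → V≡ u v k ⇔ V≡ e₁ q k
  by-edges (inj₁ (Tu≡e₁ , Tv≡q)) = V≡-cong-act T U Tu≡e₁ Tv≡q
  by-edges (inj₂ (Tu≡q , Tv≡e₁)) = ⇔.trans (V≡-cong-act T U Tu≡q Tv≡e₁) (mk⇔ (V≡-swap q e₁) (V≡-swap e₁ q))

module _ (F : ℤ² → ℤ² → ℤ² → Set) (F-act : ∀ M u v w → F u v w → F (act M u) (act M v) (act M w)) where

  private
    AllInterior-act⁺ : ∀ T → Unimodular T → ∀ u v → AllInterior F u v → AllInterior F (act T u) (act T v)
    AllInterior-act⁺ T U u v all-F w int = subst (F (act T u) (act T v)) (inverse-actʳ T U w)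
      (F-act T u v (act (inverse T) w) (all-F (act (inverse T) w)
        (subst₂ (λ u′ v′ → InInterior u′ v′ (ι² (act (inverse T) w))) (inverse-actˡ T U u) (inverse-actˡ T U v)
          (act-InInterior (inverse T) (act T u) (act T v) w int))))

  AllInterior-act : ∀ T → Unimodular T → ∀ u v → AllInterior F u v ⇔ AllInterior F (act T u) (act T v)
  AllInterior-act T U u v = mk⇔ (AllInterior-act⁺ T U u v) λ all-F →
    subst₂ (AllInterior F) (inverse-actˡ T U u) (inverse-actˡ T U v)
      (AllInterior-act⁺ (inverse T) (Unimodular-inverse T U) (act T u) (act T v) all-F)

  AllInterior-cong-act : ∀ T → Unimodular T → ∀ {u v p q} → act T u ≡ p → act T v ≡ q →
    AllInterior F u v ⇔ AllInterior F p q
  AllInterior-cong-act T U {u} {v} refl refl = AllInterior-act T U u v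

module CleanParallelogram (u v : ℤ²) (det≢0 : det u v ≢ + 0) (clean : Clean u v)
                          (m : ℕ) (area≡ : area u v ≡ suc (suc m)) where
  private
    n : ℕ
    n = suc (suc m)

  normal-form′ : NormalForm u v n
  normal-form′ = normal-form u v m (Clean⇒Visible u v det≢0 clean)
    (Clean⇒Visible v u (det-swap-≢0 u v det≢0) (Clean-swap u v clean)) area≡

  existence : ∃[ T ] ∃[ a ] (Unimodular T × 1 ≤ a × a < n × gcd a n ≡ 1 × MapsOnto T u v e₁ (+ a , + n))
  existence = onto normal-form′
    where
    onto : NormalForm u v n → ∃[ T ] ∃[ a ] (Unimodular T × 1 ≤ a × a < n × gcd a n ≡ 1 × MapsOnto T u v e₁ (+ a , + n))
    onto (T , a , U , 1≤a , a<n , coprime , Tu≡e₁ , Tv≡q) =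
      T , a , U , 1≤a , a<n , coprime , act⇒MapsOnto T u v _ _ Tu≡e₁ Tv≡q

  classification : ∀ T a → Unimodular T → 1 ≤ a → a < n → gcd a n ≡ 1 → MapsOnto T u v e₁ (+ a , + n) →
    (V≡ u v 1 ⇔ a ≡ suc m) × (V≡ u v (suc m) ⇔ a ≡ 1)
  classification T a U 1≤a a<n coprime onto =
    ⇔.trans (V≡-transfer T u v a (suc m) U onto area≡) (V[P[a,n]]≡1⇔a≡n-1 (suc m) a (s≤s z≤n) 1≤a a<n) ,
    ⇔.trans (V≡-transfer T u v a (suc m) U onto area≡) (V[P[a,n]]≡n-1⇔a≡1 (suc m) a 1≤a a<n coprime)

  main-diagonal : V≡ u v 1 ⇔ AllInterior OnMainDiag u v
  main-diagonal = from-normal-form normal-form′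
    where
    from-normal-form : NormalForm u v n → V≡ u v 1 ⇔ AllInterior OnMainDiag u v
    from-normal-form (T , a , U , 1≤a , a<n , coprime , Tu≡e₁ , Tv≡q) =
      ⇔.trans (proj₁ (classification T a U 1≤a a<n coprime (act⇒MapsOnto T u v _ _ Tu≡e₁ Tv≡q)))
        (⇔.trans (⇔.sym (on-main-diagonal⇔a≡n-1 (suc m) a 1≤a a<n))
          (⇔.sym (AllInterior-cong-act OnMainDiag act-OnMainDiag T U Tu≡e₁ Tv≡q)))

  anti-diagonal : V≡ u v (suc m) ⇔ AllInterior OnAntiDiag u v
  anti-diagonal = from-normal-form normal-form′
    where
    from-normal-form : NormalForm u v n → V≡ u v (suc m) ⇔ AllInterior OnAntiDiag u v
    from-normal-form (T , a , U , 1≤a , a<n , coprime , Tu≡e₁ , Tv≡q) =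
      ⇔.trans (proj₂ (classification T a U 1≤a a<n coprime (act⇒MapsOnto T u v _ _ Tu≡e₁ Tv≡q)))
        (⇔.trans (⇔.sym (on-anti-diagonal⇔a≡1 (suc m) a 1≤a a<n))
          (⇔.sym (AllInterior-cong-act OnAntiDiag act-OnAntiDiag T U Tu≡e₁ Tv≡q)))

theorem2 : (u v : ℤ²) → det u v ≢ + 0 → Clean u v → 2 ≤ area u v →
    (∃[ T ] ∃[ a ] (Unimodular T × 1 ≤ a × a < area u v × gcd a (area u v) ≡ 1
        × MapsOnto T u v e₁ (+ a , + area u v)))
    × (∀ (T : Mat2) (a : ℕ) → Unimodular T → 1 ≤ a → a < area u v → gcd a (area u v) ≡ 1
        → MapsOnto T u v e₁ (+ a , + area u v)
        → (V≡ u v 1 ⇔ a ≡ area u v ∸ 1) × (V≡ u v (area u v ∸ 1) ⇔ a ≡ 1))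
    × (V≡ u v 1 ⇔ (∀ w → InInterior u v (ι² w) → OnMainDiag u v w))
    × (V≡ u v (area u v ∸ 1) ⇔ (∀ w → InInterior u v (ι² w) → OnAntiDiag u v w))
theorem2 u v det≢0 clean 2≤n with area u v in area≡
... | suc (suc m) = existence , classification , main-diagonal , anti-diagonal
  where open CleanParallelogram u v det≢0 clean m area≡
theorem2 u v det≢0 clean () | 0
theorem2 u v det≢0 clean (s≤s ()) | 1
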